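{- For two positive integers $n$ and $t$ with $\max\{n,t\}\geq 4$, $p(P_n\Box P_t)=\frac{n_o(P_n\Box P_t)}{2}$.
   Context: All graphs are finite, simple and undirected. $P_k$ is the path on $k$ vertices. A path decomposition of a graph is a collection of edge-disjoint paths covering all its edges; $p(G)$ denotes the minimum number of paths in a path decomposition of $G$. $n_o(G)$ denotes the number of vertices of odd degree in $G$. The Cartesian product $G\Box H$ has vertex set $V(G)\times V(H)$, with $(u_1,v_1)(u_2,v_2)$ an edge iff either $u_1u_2\in E(G)$ and $v_1=v_2$, or $v_1v_2\in E(H)$ and $u_1=u_2$. -}

module Defs where

open import Data.Nat using (ℕ; zero; suc; _+_; _≤_)
open import Data.Nat.Properties using (suc-injective) renaming (_≟_ to _≟ℕ_)
open import Data.Nat.Base using (_%_)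
open import Data.Fin using (Fin; toℕ)
open import Data.Fin.Properties using () renaming (_≟_ to _≟F_)
open import Data.List using (List; []; _∷_; length; filter; cartesianProduct; allFin; map)
open import Data.Nat.ListAction using (sum)
open import Data.List.Relation.Unary.Unique.Propositional using (Unique)
open import Data.List.Relation.Unary.Linked using (Linked)
open import Data.Product using (_×_; _,_; Σ; Σ-syntax)
open import Data.Product.Properties using (≡-dec)
open import Data.Sum using (_⊎_)
open import Relation.Binary.Definitions using (DecidableEquality; Decidable)
open import Relation.Binary.PropositionalEquality using (_≡_)
open import Relation.Nullary using (Dec; ¬_; yes; no)
open import Relation.Nullary.Decidable using (_×-dec_; _⊎-dec_)

-- A finite simple graph.  `vertices` is a list enumerating every vertex
-- exactly once (guaranteed by construction for the graphs used below);
-- `Adj` is the (decidable, symmetric, irreflexive) adjacency relation.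
record Graph : Set₁ where
  field
    V        : Set
    _≟V_     : DecidableEquality V
    vertices : List V
    Adj      : V → V → Set
    adj?     : Decidable Adj
    symm     : ∀ {u v} → Adj u v → Adj v u
    irrefl   : ∀ {u} → ¬ Adj u u

open Graph public

degree : (G : Graph) → V G → ℕ
degree G v = length (filter (adj? G v) (vertices G))

n-odd : Graph → ℕ
n-odd G = length (filter (λ v → (degree G v % 2) ≟ℕ 1) (vertices G))

PAdj : ∀ {n} → Fin n → Fin n → Set
PAdj i j = (suc (toℕ i) ≡ toℕ j) ⊎ (suc (toℕ j) ≡ toℕ i)

private
  suc≢ : ∀ m → ¬ (suc m ≡ m)
  suc≢ zero ()
  suc≢ (suc m) e = suc≢ m (suc-injective e)

  pirr : ∀ {n} {i : Fin n} → ¬ PAdj i i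
  pirr {i = i} (Data.Sum.inj₁ e) = suc≢ (toℕ i) e
  pirr {i = i} (Data.Sum.inj₂ e) = suc≢ (toℕ i) e

  psym : ∀ {n} {i j : Fin n} → PAdj i j → PAdj j i
  psym (Data.Sum.inj₁ e) = Data.Sum.inj₂ e
  psym (Data.Sum.inj₂ e) = Data.Sum.inj₁ e

P : ℕ → Graph
P n = record
  { V = Fin n
  ; _≟V_ = _≟F_
  ; vertices = allFin n
  ; Adj = PAdj
  ; adj? = λ i j → (suc (toℕ i) ≟ℕ toℕ j) ⊎-dec (suc (toℕ j) ≟ℕ toℕ i)
  ; symm = psym
  ; irrefl = pirr
  }

□Adj : (G H : Graph) → V G × V H → V G × V H → Set
□Adj G H (u₁ , v₁) (u₂ , v₂) = (Adj G u₁ u₂ × v₁ ≡ v₂) ⊎ (u₁ ≡ u₂ × Adj H v₁ v₂)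

private
  □sym : (G H : Graph) → ∀ {x y} → □Adj G H x y → □Adj G H y x
  □sym G H (Data.Sum.inj₁ (a , Relation.Binary.PropositionalEquality.refl)) =
    Data.Sum.inj₁ (symm G a , Relation.Binary.PropositionalEquality.refl)
  □sym G H (Data.Sum.inj₂ (Relation.Binary.PropositionalEquality.refl , a)) =
    Data.Sum.inj₂ (Relation.Binary.PropositionalEquality.refl , symm H a)

  □irr : (G H : Graph) → ∀ {x} → ¬ □Adj G H x x
  □irr G H (Data.Sum.inj₁ (a , _)) = irrefl G a
  □irr G H (Data.Sum.inj₂ (_ , a)) = irrefl H a

_□_ : Graph → Graph → Graph
G □ H = record
  { V = V G × V H
  ; _≟V_ = ≡-dec (_≟V_ G) (_≟V_ H)
  ; vertices = cartesianProduct (vertices G) (vertices H)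
  ; Adj = □Adj G H
  ; adj? = λ { (u₁ , v₁) (u₂ , v₂) →
      (adj? G u₁ u₂ ×-dec (_≟V_ H v₁ v₂)) ⊎-dec (_≟V_ G u₁ u₂ ×-dec adj? H v₁ v₂) }
  ; symm = □sym G H
  ; irrefl = □irr G H
  }

record Path (G : Graph) : Set where
  field
    verts    : List (V G)
    nontriv  : 2 ≤ length verts
    distinct : Unique verts
    linked   : Linked (Adj G) verts

open Path public

isEdge : (G : Graph) → V G → V G → V G → V G → ℕ
isEdge G u v a b with ((_≟V_ G a u ×-dec _≟V_ G b v) ⊎-dec (_≟V_ G a v ×-dec _≟V_ G b u))
... | yes _ = 1
... | no  _ = 0

edgeOccFrom : (G : Graph) → V G → V G → V G → List (V G) → ℕ
edgeOccFrom G u v a [] = 0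
edgeOccFrom G u v a (b ∷ xs) = isEdge G u v a b + edgeOccFrom G u v b xs

edgeOcc : (G : Graph) → V G → V G → List (V G) → ℕ
edgeOcc G u v [] = 0
edgeOcc G u v (a ∷ xs) = edgeOccFrom G u v a xs

-- A path decomposition: a list of paths such that every edge of G lies in
-- exactly one of them (edge-disjoint and covering all edges).
IsPathDecomposition : (G : Graph) → List (Path G) → Set
IsPathDecomposition G D =
  ∀ u v → Adj G u v → sum (map (λ p → edgeOcc G u v (verts p)) D) ≡ 1

PathDecomposition : Graph → Set
PathDecomposition G = Σ[ D ∈ List (Path G) ] IsPathDecomposition G D

PathNumberIs : Graph → ℕ → Set
PathNumberIs G k =
  (Σ[ D ∈ PathDecomposition G ] length (Data.Product.proj₁ D) ≡ k)
  × (∀ (D : PathDecomposition G) → k ≤ length (Data.Product.proj₁ D))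

-- In a path decomposition every edge at v is used once, so deg v + (number of path ends at v)
-- = 2 · (number of visits of v). Hence every odd-degree vertex is an end of some path, giving
-- p(G) ≥ n_o/2, and a decomposition in which no vertex is an end twice has exactly n_o/2 paths.
-- For P_n □ P_t such decompositions are written down in the grid ℕ × ℕ from pieces of rows and
-- columns (up to transposition, n = 1 or n ≥ 2 and t ≥ 4); their edge-disjointness and covering
-- are checked by counting.

module Submission where

open import Defs
open import Algebra.Properties.CommutativeSemigroup using (interchange)
open import Data.Empty using (⊥-elim)
open import Data.Fin using (Fin; toℕ; fromℕ<)
open import Data.Fin.Properties using (toℕ-injective; toℕ-fromℕ<; toℕ<n)
open import Data.List using (List; []; _∷_; _++_; length; map; concatMap; filter; cartesianProduct; upTo; applyUpTo; applyDownFrom)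
open import Data.List.Properties using (length-map; length-++; length-upTo; length-applyUpTo; length-applyDownFrom; map-upTo; map-concatMap; concatMap-map; concatMap-cong; concatMap-++)
open import Data.List.Membership.Propositional using (_∈_)
open import Data.List.Membership.Propositional.Properties using (∈-cartesianProduct⁺; ∈-cartesianProduct⁻; ∈-allFin; ∈-upTo⁺; ∈-upTo⁻; ∈-map⁺; ∈-map⁻; ∈-++⁺ˡ; ∈-++⁺ʳ; ∈-++⁻)
open import Data.List.Relation.Binary.Permutation.Propositional using (_↭_; prep; ↭-refl; ↭-sym; ↭-trans; ↭⇒↭ₛ)
import Data.List.Relation.Binary.Permutation.Propositional.Properties as ↭
import Data.List.Relation.Binary.Permutation.Setoid.Properties as ↭ₛ
open import Data.List.Relation.Unary.All as All using (All; []; _∷_)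
import Data.List.Relation.Unary.All.Properties as All
open import Data.List.Relation.Unary.AllPairs using ([]; _∷_)
open import Data.List.Relation.Unary.Any using (here; there)
open import Data.List.Relation.Unary.Linked as Linked using (Linked; []; [-]; _∷_)
import Data.List.Relation.Unary.Linked.Properties as Linked
open import Data.List.Relation.Unary.Unique.Propositional using (Unique)
import Data.List.Relation.Unary.Unique.Propositional.Properties as Unique
open import Data.Nat using (ℕ; zero; suc; pred; _+_; _*_; _∸_; _<_; _≤_; _⊔_; _/_; _%_; z≤n; s≤s)
open import Data.Nat.DivMod using (m*n%n≡0; [m+kn]%n≡m%n; m*n/n≡m; /-monoˡ-≤)
open import Data.Nat.ListAction using (sum)
open import Data.Nat.Properties hiding (_≟_)
open import Data.Nat.Properties using () renaming (_≟_ to _≟ℕ_)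
open import Data.Nat.Tactic.RingSolver using (solve-∀)
open import Data.Product using (_×_; _,_; proj₁; proj₂; swap)
import Data.Product as Product
open import Data.Sum using (_⊎_; inj₁; inj₂)
import Data.Sum as Sum
open import Function using (_∘_)
open import Relation.Binary.Definitions using (DecidableEquality)
open import Relation.Binary.PropositionalEquality
import Relation.Binary.PropositionalEquality as ≡
open import Relation.Nullary using (Dec; yes; no; ¬_)
open import Relation.Nullary.Decidable using (_×-dec_; _⊎-dec_)

𝟙 : ∀ {a} {A : Set a} → Dec A → ℕ
𝟙 (yes _) = 1
𝟙 (no _)  = 0

module _ {a} {A : Set a} where

  𝟙-yes : A → (d : Dec A) → 𝟙 d ≡ 1
  𝟙-yes x (yes _) = refl
  𝟙-yes x (no ¬x) = ⊥-elim (¬x x)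

  𝟙-no : ¬ A → (d : Dec A) → 𝟙 d ≡ 0
  𝟙-no ¬x (yes x) = ⊥-elim (¬x x)
  𝟙-no ¬x (no _)  = refl

  𝟙≤1 : (d : Dec A) → 𝟙 d ≤ 1
  𝟙≤1 (yes _) = s≤s z≤n
  𝟙≤1 (no _)  = z≤n

module _ {a b} {A : Set a} {B : Set b} where

  𝟙-cong : (A → B) → (B → A) → (d : Dec A) (e : Dec B) → 𝟙 d ≡ 𝟙 e
  𝟙-cong f g (yes x) e = sym (𝟙-yes (f x) e)
  𝟙-cong f g (no ¬x) e = sym (𝟙-no (λ y → ¬x (g y)) e)

  𝟙-× : (d : Dec A) (e : Dec B) → 𝟙 (d ×-dec e) ≡ 𝟙 d * 𝟙 e
  𝟙-× (yes _) (yes _) = refl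
  𝟙-× (yes _) (no _)  = refl
  𝟙-× (no _)  _       = refl

  𝟙-⊎ : ¬ (A × B) → (d : Dec A) (e : Dec B) → 𝟙 (d ⊎-dec e) ≡ 𝟙 d + 𝟙 e
  𝟙-⊎ excl (yes x) (yes y) = ⊥-elim (excl (x , y))
  𝟙-⊎ excl (yes _) (no _)  = refl
  𝟙-⊎ excl (no _)  (yes _) = refl
  𝟙-⊎ excl (no _)  (no _)  = refl

∑ : ∀ {a} {A : Set a} → List A → (A → ℕ) → ℕ
∑ xs f = sum (map f xs)

module _ {a} {A : Set a} where

  ∑-cong : ∀ xs {f g : A → ℕ} → (∀ x → f x ≡ g x) → ∑ xs f ≡ ∑ xs g
  ∑-cong []       f≗g = refl
  ∑-cong (x ∷ xs) f≗g = cong₂ _+_ (f≗g x) (∑-cong xs f≗g)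

  ∑-mono : ∀ xs {f g : A → ℕ} → (∀ x → f x ≤ g x) → ∑ xs f ≤ ∑ xs g
  ∑-mono []       f≤g = z≤n
  ∑-mono (x ∷ xs) f≤g = +-mono-≤ (f≤g x) (∑-mono xs f≤g)

  ∑-const : ∀ xs c → ∑ xs (λ (_ : A) → c) ≡ length xs * c
  ∑-const []       c = refl
  ∑-const (x ∷ xs) c = cong (c +_) (∑-const xs c)

  ∑-zero : ∀ xs → ∑ xs (λ (_ : A) → 0) ≡ 0
  ∑-zero xs = trans (∑-const xs 0) (*-zeroʳ (length xs))

  ∑-+ : ∀ xs (f g : A → ℕ) → ∑ xs (λ x → f x + g x) ≡ ∑ xs f + ∑ xs g
  ∑-+ []       f g = refl
  ∑-+ (x ∷ xs) f g =
    trans (cong (f x + g x +_) (∑-+ xs f g)) (interchange +-commutativeSemigroup (f x) (g x) (∑ xs f) (∑ xs g))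

  ∑-*ˡ : ∀ xs c (f : A → ℕ) → ∑ xs (λ x → c * f x) ≡ c * ∑ xs f
  ∑-*ˡ []       c f = sym (*-zeroʳ c)
  ∑-*ˡ (x ∷ xs) c f = trans (cong (c * f x +_) (∑-*ˡ xs c f)) (sym (*-distribˡ-+ c (f x) (∑ xs f)))

  ∑-++ : ∀ xs ys (f : A → ℕ) → ∑ (xs ++ ys) f ≡ ∑ xs f + ∑ ys f
  ∑-++ []       ys f = refl
  ∑-++ (x ∷ xs) ys f = trans (cong (f x +_) (∑-++ xs ys f)) (sym (+-assoc (f x) _ _))

  ∑-∈ : ∀ {x xs} (f : A → ℕ) → x ∈ xs → f x ≤ ∑ xs f
  ∑-∈ f (here refl)        = m≤m+n _ _
  ∑-∈ {xs = y ∷ _} f (there x∈xs) = ≤-trans (∑-∈ f x∈xs) (m≤n+m _ (f y))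

module _ {a b} {A : Set a} {B : Set b} where

  ∑-map : ∀ (g : A → B) xs (f : B → ℕ) → ∑ (map g xs) f ≡ ∑ xs (λ x → f (g x))
  ∑-map g []       f = refl
  ∑-map g (x ∷ xs) f = cong (f (g x) +_) (∑-map g xs f)

  ∑-comm : ∀ xs ys (f : A → B → ℕ) → ∑ xs (λ x → ∑ ys (f x)) ≡ ∑ ys (λ y → ∑ xs (λ x → f x y))
  ∑-comm []       ys f = sym (∑-zero ys)
  ∑-comm (x ∷ xs) ys f = trans (cong (∑ ys (f x) +_) (∑-comm xs ys f)) (sym (∑-+ ys (f x) _))

  ∑-concatMap : ∀ (g : A → List B) xs (f : B → ℕ) → ∑ (concatMap g xs) f ≡ ∑ xs (λ x → ∑ (g x) f)
  ∑-concatMap g []       f = refl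
  ∑-concatMap g (x ∷ xs) f = trans (∑-++ (g x) _ f) (cong (∑ (g x) f +_) (∑-concatMap g xs f))

length-filter≡∑𝟙 : ∀ {a p} {A : Set a} {P : A → Set p} (P? : ∀ x → Dec (P x)) xs →
                   length (filter P? xs) ≡ ∑ xs (λ x → 𝟙 (P? x))
length-filter≡∑𝟙 P? []       = refl
length-filter≡∑𝟙 P? (x ∷ xs) with P? x
... | yes _ = cong suc (length-filter≡∑𝟙 P? xs)
... | no _  = length-filter≡∑𝟙 P? xs

module _ {a} {A : Set a} (f : A → ℕ) where

  length≤∑ : ∀ xs → (∀ x → x ∈ xs → 1 ≤ f x) → length xs ≤ ∑ xs f
  length≤∑ []       f≥1 = z≤n
  length≤∑ (x ∷ xs) f≥1 = +-mono-≤ (f≥1 x (here refl)) (length≤∑ xs (λ y y∈ → f≥1 y (there y∈)))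

  private
    tight : ∀ y xs → (∀ x → x ∈ y ∷ xs → 1 ≤ f x) → ∑ (y ∷ xs) f ≡ length (y ∷ xs) →
            f y ≡ 1 × ∑ xs f ≡ length xs
    tight y xs f≥1 ∑≡ = split (f y) (∑ xs f) (length xs) ∑≡ (f≥1 y (here refl))
                              (length≤∑ xs (λ z z∈ → f≥1 z (there z∈)))
      where
      split : ∀ a b c → a + b ≡ suc c → 1 ≤ a → c ≤ b → a ≡ 1 × b ≡ c
      split (suc zero)    b c e _ _   = refl , suc-injective e
      split (suc (suc a)) b c e _ c≤b = ⊥-elim (m+n≮n a b (subst (_≤ b) (sym (suc-injective e)) c≤b))

  ∑≡length⇒≡1 : ∀ xs → (∀ x → x ∈ xs → 1 ≤ f x) → ∑ xs f ≡ length xs → ∀ x → x ∈ xs → f x ≡ 1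
  ∑≡length⇒≡1 (y ∷ xs) f≥1 ∑≡ .y (here refl) = proj₁ (tight y xs f≥1 ∑≡)
  ∑≡length⇒≡1 (y ∷ xs) f≥1 ∑≡ x  (there x∈)  =
    ∑≡length⇒≡1 xs (λ z z∈ → f≥1 z (there z∈)) (proj₂ (tight y xs f≥1 ∑≡)) x x∈

multiplicity : {A : Set} → DecidableEquality A → A → List A → ℕ
multiplicity _≟_ v xs = ∑ xs (λ x → 𝟙 (x ≟ v))

module _ {A : Set} (_≟_ : DecidableEquality A) where

  𝟙-≟-sym : ∀ x y → 𝟙 (x ≟ y) ≡ 𝟙 (y ≟ x)
  𝟙-≟-sym x y = 𝟙-cong sym sym (x ≟ y) (y ≟ x)

  multiplicity-∉ : ∀ {v} xs → All (v ≢_) xs → multiplicity _≟_ v xs ≡ 0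
  multiplicity-∉ []       []          = refl
  multiplicity-∉ {v} (x ∷ xs) (v≢x ∷ v∉) = cong₂ _+_ (𝟙-no (λ x≡v → v≢x (sym x≡v)) (x ≟ v)) (multiplicity-∉ xs v∉)

  multiplicity-unique : ∀ {v} xs → Unique xs → multiplicity _≟_ v xs ≤ 1
  multiplicity-unique []       []          = z≤n
  multiplicity-unique {v} (x ∷ xs) (x∉ ∷ uniq) with x ≟ v
  ... | yes refl = ≤-reflexive (cong suc (multiplicity-∉ xs x∉))
  ... | no _     = multiplicity-unique xs uniq

  multiplicity-unique-∈ : ∀ {v} xs → Unique xs → v ∈ xs → multiplicity _≟_ v xs ≡ 1
  multiplicity-unique-∈ (x ∷ xs) (x∉ ∷ _) (here refl) =
    cong₂ _+_ (𝟙-yes refl (x ≟ x)) (multiplicity-∉ xs x∉)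
  multiplicity-unique-∈ {v} (x ∷ xs) (x∉ ∷ uniq) (there v∈) =
    cong₂ _+_ (𝟙-no (λ { refl → All.lookup x∉ v∈ refl }) (x ≟ v)) (multiplicity-unique-∈ xs uniq v∈)

  ∑-multiplicity : ∀ vs xs → (∀ x → multiplicity _≟_ x vs ≡ 1) → ∑ vs (λ v → multiplicity _≟_ v xs) ≡ length xs
  ∑-multiplicity vs xs once = begin
    ∑ vs (λ v → ∑ xs (λ x → 𝟙 (x ≟ v)))  ≡⟨ ∑-comm vs xs (λ v x → 𝟙 (x ≟ v)) ⟩
    ∑ xs (λ x → ∑ vs (λ v → 𝟙 (x ≟ v)))  ≡⟨ ∑-cong xs (λ x → trans (∑-cong vs (𝟙-≟-sym x)) (once x)) ⟩
    ∑ xs (λ _ → 1)                        ≡⟨ trans (∑-const xs 1) (*-identityʳ (length xs)) ⟩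
    length xs                             ∎
    where open ≡-Reasoning

module _ {A : Set} where

  unique-↭ : ∀ {xs ys : List A} → xs ↭ ys → Unique xs → Unique ys
  unique-↭ xs↭ys = ↭ₛ.Unique-resp-↭ (≡.setoid A) (↭⇒↭ₛ xs↭ys)

  unique-++-separated : ∀ {p} (P : A → Set p) {xs ys} → Unique xs → Unique ys → All P xs → All (¬_ ∘ P) ys → Unique (xs ++ ys)
  unique-++-separated P uxs uys Pxs ¬Pys = Unique.++⁺ uxs uys (λ (v∈xs , v∈ys) → All.lookup ¬Pys v∈ys (All.lookup Pxs v∈xs))

  all-map-upTo : ∀ {p} {P : A → Set p} (g : ℕ → A) k → (∀ {s} → s < k → P (g s)) → All P (map g (upTo k))
  all-map-upTo {P = P} g k Pg = subst (All P) (sym (map-upTo g k)) (All.applyUpTo⁺₁ g k Pg)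

  unique-map-upTo : ∀ (g : ℕ → A) k → (∀ {i j} → g i ≡ g j → i ≡ j) → Unique (map g (upTo k))
  unique-map-upTo g k g-inj = Unique.map⁺ g-inj (Unique.upTo⁺ k)

  concatMap-pairs-↭ : ∀ {B : Set} (g h : B → A) xs ys →
                      concatMap (λ x → g x ∷ h x ∷ []) xs ++ ys ↭ map g xs ++ map h xs ++ ys
  concatMap-pairs-↭ g h []       ys = ↭-refl
  concatMap-pairs-↭ g h (x ∷ xs) ys =
    prep (g x) (↭-trans (prep (h x) (concatMap-pairs-↭ g h xs ys)) (↭-sym (↭.shift (h x) (map g xs) (map h xs ++ ys))))

  1≤length-++-∷ : ∀ (xs : List A) y ys → 1 ≤ length (xs ++ y ∷ ys)
  1≤length-++-∷ []      y ys = s≤s z≤n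
  1≤length-++-∷ (_ ∷ _) y ys = s≤s z≤n

  all-≢ : ∀ {p} {P : A → Set p} {x xs} → ¬ P x → All P xs → All (x ≢_) xs
  all-≢ {P = P} ¬Px = All.map (λ Pz x≡z → ¬Px (subst P (sym x≡z) Pz))

lastOf : ∀ {a} {A : Set a} → A → List A → A
lastOf a []       = a
lastOf a (b ∷ ys) = lastOf b ys

endpoints : ∀ {a} {A : Set a} → List A → List A
endpoints []       = []
endpoints (a ∷ ys) = a ∷ lastOf a ys ∷ []

module _ {a b} {A : Set a} {B : Set b} (f : A → B) where

  lastOf-map : ∀ x ys → f (lastOf x ys) ≡ lastOf (f x) (map f ys)
  lastOf-map x []       = refl
  lastOf-map x (y ∷ ys) = lastOf-map y ys

  endpoints-map : ∀ xs → map f (endpoints xs) ≡ endpoints (map f xs)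
  endpoints-map []       = refl
  endpoints-map (x ∷ ys) = cong (λ z → f x ∷ z ∷ []) (lastOf-map x ys)

  map-concatMap-endpoints : ∀ {c} {C : Set c} (g : C → List A) xs →
    map f (concatMap (λ x → endpoints (g x)) xs) ≡ concatMap endpoints (map (λ x → map f (g x)) xs)
  map-concatMap-endpoints g xs = begin
    map f (concatMap (λ x → endpoints (g x)) xs)         ≡⟨ map-concatMap f (λ x → endpoints (g x)) xs ⟩
    concatMap (λ x → map f (endpoints (g x))) xs         ≡⟨ concatMap-cong (λ x → endpoints-map (g x)) xs ⟩
    concatMap (λ x → endpoints (map f (g x))) xs         ≡⟨ concatMap-map endpoints (λ x → map f (g x)) xs ⟨
    concatMap endpoints (map (λ x → map f (g x)) xs)     ∎
    where open ≡-Reasoning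

module _ {a} {A : Set a} where

  data Consecutive (u v : A) : List A → Set a where
    here  : ∀ {xs} → Consecutive u v (u ∷ v ∷ xs)
    there : ∀ {x xs} → Consecutive u v xs → Consecutive u v (x ∷ xs)

  consecutive-++ˡ : ∀ {u v xs} ys → Consecutive u v xs → Consecutive u v (xs ++ ys)
  consecutive-++ˡ ys here      = here
  consecutive-++ˡ ys (there c) = there (consecutive-++ˡ ys c)

  consecutive-++ʳ : ∀ {u v} xs {ys} → Consecutive u v ys → Consecutive u v (xs ++ ys)
  consecutive-++ʳ []       c = c
  consecutive-++ʳ (x ∷ xs) c = there (consecutive-++ʳ xs c)

  consecutive-join : ∀ (x : A) xs y ys → Consecutive (lastOf x xs) y (x ∷ xs ++ y ∷ ys)
  consecutive-join x []       y ys = here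
  consecutive-join x (z ∷ xs) y ys = there (consecutive-join z xs y ys)

  consecutive-applyUpTo : ∀ (f : ℕ → A) {i n} → suc i < n → Consecutive (f i) (f (suc i)) (applyUpTo f n)
  consecutive-applyUpTo f {zero}  {suc zero}    (s≤s ())
  consecutive-applyUpTo f {zero}  {suc (suc n)} _           = here
  consecutive-applyUpTo f {suc i} {suc n}       (s≤s i+1<n) = there (consecutive-applyUpTo (f ∘ suc) i+1<n)

  consecutive-applyDownFrom : ∀ (f : ℕ → A) {i n} → suc i < n → Consecutive (f (suc i)) (f i) (applyDownFrom f n)
  consecutive-applyDownFrom f {i} {suc n} (s≤s i+1≤n) with m≤n⇒m<n∨m≡n i+1≤n
  ... | inj₁ i+1<n = there (consecutive-applyDownFrom f i+1<n)
  ... | inj₂ refl  = here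

  lastOf-++ : ∀ (x : A) xs y ys → lastOf x (xs ++ y ∷ ys) ≡ lastOf y ys
  lastOf-++ x []       y ys = refl
  lastOf-++ x (z ∷ xs) y ys = lastOf-++ z xs y ys

  lastOf-applyUpTo : ∀ (f : ℕ → A) k → lastOf (f 0) (applyUpTo (f ∘ suc) k) ≡ f k
  lastOf-applyUpTo f zero    = refl
  lastOf-applyUpTo f (suc k) = lastOf-applyUpTo (f ∘ suc) k

  lastOf-applyDownFrom : ∀ (f : ℕ → A) k → lastOf (f k) (applyDownFrom f k) ≡ f 0
  lastOf-applyDownFrom f zero    = refl
  lastOf-applyDownFrom f (suc k) = lastOf-applyDownFrom f k

  linked-join : ∀ {ℓ} {R : A → A → Set ℓ} x xs y ys →
                Linked R (x ∷ xs) → R (lastOf x xs) y → Linked R (y ∷ ys) → Linked R (x ∷ xs ++ y ∷ ys)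
  linked-join x []       y ys _          xRy lk = xRy ∷ lk
  linked-join x (z ∷ xs) y ys (xRz ∷ lk₁) zRy lk = xRz ∷ linked-join z xs y ys lk₁ zRy lk

-- The parity bound for path decompositions

EnumeratesVertices : Graph → Set
EnumeratesVertices G = ∀ v → multiplicity (_≟V_ G) v (vertices G) ≡ 1

pathEnds : {G : Graph} → List (Path G) → List (V G)
pathEnds = concatMap (λ p → endpoints (verts p))

length-pathEnds : {G : Graph} (D : List (Path G)) → length (pathEnds D) ≡ length D * 2
length-pathEnds [] = refl
length-pathEnds (p ∷ D) with verts p | nontriv p
... | _ ∷ _ | _ = cong (λ n → suc (suc n)) (length-pathEnds D)

%2-even : ∀ k → (2 * k) % 2 ≡ 0
%2-even k = trans (cong (_% 2) (*-comm 2 k)) (m*n%n≡0 k 2)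

%2-odd : ∀ k → (1 + 2 * k) % 2 ≡ 1
%2-odd k = trans (cong (λ m → (1 + m) % 2) (*-comm 2 k)) ([m+kn]%n≡m%n 1 k 2)

module _ (d : ℕ) where
  private
    odd? : Dec (d % 2 ≡ 1)
    odd? = d % 2 ≟ℕ 1

  𝟙-odd≡ : ∀ e k → d + e ≡ 2 * k → e ≤ 1 → 𝟙 odd? ≡ e
  𝟙-odd≡ 0 k d+0≡2k _ = 𝟙-no (λ odd → 0≢1+n (trans (sym even) odd)) odd?
    where even : d % 2 ≡ 0
          even = trans (cong (_% 2) (trans (sym (+-identityʳ d)) d+0≡2k)) (%2-even k)
  𝟙-odd≡ 1 zero d+1≡0 _ = ⊥-elim (1+n≢0 (trans (+-comm 1 d) d+1≡0))
  𝟙-odd≡ 1 (suc k) d+1≡2k _ = 𝟙-yes (trans (cong (_% 2) d≡1+2k) (%2-odd k)) odd?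
    where d≡1+2k : d ≡ 1 + 2 * k
          d≡1+2k = suc-injective (trans (+-comm 1 d) (trans d+1≡2k (*-suc 2 k)))
  𝟙-odd≡ (suc (suc e)) k _ (s≤s ())

  𝟙-odd≤ : ∀ e k → d + e ≡ 2 * k → 𝟙 odd? ≤ e
  𝟙-odd≤ 0             k d+e≡2k = ≤-reflexive (𝟙-odd≡ 0 k d+e≡2k z≤n)
  𝟙-odd≤ (suc e)       k d+e≡2k = ≤-trans (𝟙≤1 odd?) (s≤s z≤n)

Traverses : (G : Graph) → V G → V G → V G → V G → Set
Traverses G u v a b = (a ≡ u × b ≡ v) ⊎ (a ≡ v × b ≡ u)

traverses? : (G : Graph) → ∀ u v a b → Dec (Traverses G u v a b)
traverses? G u v a b = (a ≟ u ×-dec b ≟ v) ⊎-dec (a ≟ v ×-dec b ≟ u)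
  where _≟_ : DecidableEquality (V G)
        _≟_ = _≟V_ G

isEdge≡𝟙 : (G : Graph) → ∀ u v a b → isEdge G u v a b ≡ 𝟙 (traverses? G u v a b)
isEdge≡𝟙 G u v a b with traverses? G u v a b
... | yes _ = refl
... | no _  = refl

isEdge-no : (G : Graph) → ∀ u v a b → ¬ Traverses G u v a b → isEdge G u v a b ≡ 0
isEdge-no G u v a b ¬uv = trans (isEdge≡𝟙 G u v a b) (𝟙-no ¬uv (traverses? G u v a b))

isEdge-cong : (G H : Graph) → ∀ u v a b u′ v′ a′ b′ →
  (Traverses G u v a b → Traverses H u′ v′ a′ b′) → (Traverses H u′ v′ a′ b′ → Traverses G u v a b) →
  isEdge G u v a b ≡ isEdge H u′ v′ a′ b′
isEdge-cong G H u v a b u′ v′ a′ b′ to from =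
  trans (isEdge≡𝟙 G u v a b)
    (trans (𝟙-cong to from (traverses? G u v a b) (traverses? H u′ v′ a′ b′)) (sym (isEdge≡𝟙 H u′ v′ a′ b′)))

module _ (G : Graph) where
  private
    _≟_ : DecidableEquality (V G)
    _≟_ = _≟V_ G
    mult : V G → List (V G) → ℕ
    mult = multiplicity _≟_
    δ : V G → V G → ℕ
    δ x y = 𝟙 (x ≟ y)

  isEdge-symˡ : ∀ u v a b → isEdge G u v a b ≡ isEdge G v u a b
  isEdge-symˡ u v a b = isEdge-cong G G u v a b v u a b Sum.swap Sum.swap

  isEdge-symʳ : ∀ u v a b → isEdge G u v a b ≡ isEdge G u v b a
  isEdge-symʳ u v a b = isEdge-cong G G u v a b u v b a flip flip
    where flip : ∀ {a b x y : V G} → (a ≡ x × b ≡ y) ⊎ (a ≡ y × b ≡ x) → (b ≡ x × a ≡ y) ⊎ (b ≡ y × a ≡ x)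
          flip = Sum.swap ∘ Sum.map Product.swap Product.swap

  edgeOcc-symˡ : ∀ u v xs → edgeOcc G u v xs ≡ edgeOcc G v u xs
  edgeOcc-symˡ u v []           = refl
  edgeOcc-symˡ u v (a ∷ [])     = refl
  edgeOcc-symˡ u v (a ∷ b ∷ ys) = cong₂ _+_ (isEdge-symˡ u v a b) (edgeOcc-symˡ u v (b ∷ ys))

  consecutive⇒edgeOcc : ∀ {u v xs} → Consecutive u v xs → 1 ≤ edgeOcc G u v xs
  consecutive⇒edgeOcc {u} {v} here =
    ≤-trans (≤-reflexive (sym (trans (isEdge≡𝟙 G u v u v) (𝟙-yes (inj₁ (refl , refl)) (traverses? G u v u v))))) (m≤m+n _ _)
  consecutive⇒edgeOcc {u} {v} (there {x} {y ∷ ys} c) = ≤-trans (consecutive⇒edgeOcc c) (m≤n+m _ (isEdge G u v x y))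

  consecutive⇒edgeOcc′ : ∀ {u v xs} → Consecutive v u xs → 1 ≤ edgeOcc G u v xs
  consecutive⇒edgeOcc′ {u} {v} {xs} c = subst (1 ≤_) (edgeOcc-symˡ v u xs) (consecutive⇒edgeOcc c)

  isEdge-nonedge : ∀ {u v a b} → Adj G a b → ¬ Adj G u v → isEdge G u v a b ≡ 0
  isEdge-nonedge {u} {v} {a} {b} ab ¬uv = isEdge-no G u v a b not-uv
    where not-uv : ¬ Traverses G u v a b
          not-uv (inj₁ (refl , refl)) = ¬uv ab
          not-uv (inj₂ (refl , refl)) = ¬uv (symm G ab)

  isEdge-distinct : ∀ u v {a b} → a ≢ b → isEdge G u v a b ≡ δ a u * δ b v + δ a v * δ b u
  isEdge-distinct u v {a} {b} a≢b = begin
    isEdge G u v a b                                   ≡⟨ isEdge≡𝟙 G u v a b ⟩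
    𝟙 ((a ≟ u ×-dec b ≟ v) ⊎-dec (a ≟ v ×-dec b ≟ u))  ≡⟨ 𝟙-⊎ excl (a ≟ u ×-dec b ≟ v) (a ≟ v ×-dec b ≟ u) ⟩
    𝟙 (a ≟ u ×-dec b ≟ v) + 𝟙 (a ≟ v ×-dec b ≟ u)      ≡⟨ cong₂ _+_ (𝟙-× (a ≟ u) (b ≟ v)) (𝟙-× (a ≟ v) (b ≟ u)) ⟩
    δ a u * δ b v + δ a v * δ b u                      ∎
    where open ≡-Reasoning
          excl : ¬ ((a ≡ u × b ≡ v) × (a ≡ v × b ≡ u))
          excl ((refl , refl) , (a≡b , _)) = a≢b a≡b

  edgeOcc-nonedge : ∀ {u v} xs → Linked (Adj G) xs → ¬ Adj G u v → edgeOcc G u v xs ≡ 0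
  edgeOcc-nonedge []           _         ¬uv = refl
  edgeOcc-nonedge (a ∷ [])     _         ¬uv = refl
  edgeOcc-nonedge (a ∷ b ∷ ys) (ab ∷ lk) ¬uv =
    cong₂ _+_ (isEdge-nonedge ab ¬uv) (edgeOcc-nonedge (b ∷ ys) lk ¬uv)

  module _ (enum : EnumeratesVertices G) where
    private
      L : List (V G)
      L = vertices G

    ∑-δ : ∀ a → ∑ L (δ a) ≡ 1
    ∑-δ a = trans (∑-cong L (𝟙-≟-sym _≟_ a)) (enum a)

    ∑-isEdge : ∀ v {a b} → a ≢ b → ∑ L (λ u → isEdge G v u a b) ≡ δ a v + δ b v
    ∑-isEdge v {a} {b} a≢b = begin
      ∑ L (λ u → isEdge G v u a b)                      ≡⟨ ∑-cong L (λ u → isEdge-distinct v u a≢b) ⟩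
      ∑ L (λ u → δ a v * δ b u + δ a u * δ b v)         ≡⟨ ∑-+ L _ _ ⟩
      ∑ L (λ u → δ a v * δ b u) + ∑ L (λ u → δ a u * δ b v)
        ≡⟨ cong (∑ L (λ u → δ a v * δ b u) +_) (∑-cong L (λ u → *-comm (δ a u) (δ b v))) ⟩
      ∑ L (λ u → δ a v * δ b u) + ∑ L (λ u → δ b v * δ a u)
        ≡⟨ cong₂ _+_ (∑-*ˡ L (δ a v) (δ b)) (∑-*ˡ L (δ b v) (δ a)) ⟩
      δ a v * ∑ L (δ b) + δ b v * ∑ L (δ a)             ≡⟨ cong₂ (λ m n → δ a v * m + δ b v * n) (∑-δ b) (∑-δ a) ⟩
      δ a v * 1 + δ b v * 1                             ≡⟨ cong₂ _+_ (*-identityʳ (δ a v)) (*-identityʳ (δ b v)) ⟩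
      δ a v + δ b v                                     ∎
      where open ≡-Reasoning

    edgeOccFrom-degree : ∀ v a ys → Linked (Adj G) (a ∷ ys) →
      ∑ L (λ u → edgeOccFrom G v u a ys) + δ (lastOf a ys) v ≡ δ a v + 2 * mult v ys
    edgeOccFrom-degree v a []       _         = trans (cong (_+ δ a v) (∑-zero L)) (sym (+-identityʳ (δ a v)))
    edgeOccFrom-degree v a (b ∷ ys) (ab ∷ lk) = begin
      ∑ L (λ u → isEdge G v u a b + edgeOccFrom G v u b ys) + δ (lastOf b ys) v
        ≡⟨ cong (_+ δ (lastOf b ys) v) (∑-+ L _ _) ⟩
      ∑ L (λ u → isEdge G v u a b) + ∑ L (λ u → edgeOccFrom G v u b ys) + δ (lastOf b ys) v
        ≡⟨ +-assoc (∑ L (λ u → isEdge G v u a b)) _ _ ⟩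
      ∑ L (λ u → isEdge G v u a b) + (∑ L (λ u → edgeOccFrom G v u b ys) + δ (lastOf b ys) v)
        ≡⟨ cong₂ _+_ (∑-isEdge v (λ { refl → irrefl G ab })) (edgeOccFrom-degree v b ys lk) ⟩
      (δ a v + δ b v) + (δ b v + 2 * mult v ys)
        ≡⟨ regroup (δ a v) (δ b v) (mult v ys) ⟩
      δ a v + 2 * (δ b v + mult v ys)
        ∎
      where open ≡-Reasoning
            regroup : ∀ x y z → (x + y) + (y + 2 * z) ≡ x + 2 * (y + z)
            regroup = solve-∀

    edgeOcc-degree : ∀ v xs → Linked (Adj G) xs →
      ∑ L (λ u → edgeOcc G v u xs) + mult v (endpoints xs) ≡ 2 * mult v xs
    edgeOcc-degree v []       _  = cong (_+ 0) (∑-zero L)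
    edgeOcc-degree v (a ∷ ys) lk = begin
      S + (δ a v + (δ (lastOf a ys) v + 0))  ≡⟨ rearrange S (δ a v) (δ (lastOf a ys) v) ⟩
      (S + δ (lastOf a ys) v) + δ a v        ≡⟨ cong (_+ δ a v) (edgeOccFrom-degree v a ys lk) ⟩
      δ a v + 2 * mult v ys + δ a v          ≡⟨ double (δ a v) (mult v ys) ⟩
      2 * (δ a v + mult v ys)                ∎
      where open ≡-Reasoning
            S : ℕ
            S = ∑ L (λ u → edgeOccFrom G v u a ys)
            rearrange : ∀ x y z → x + (y + (z + 0)) ≡ (x + z) + y
            rearrange = solve-∀
            double : ∀ x y → x + 2 * y + x ≡ 2 * (x + y)
            double = solve-∀

    module _ (D : List (Path G)) (isD : IsPathDecomposition G D) where

      degree≡∑edgeOcc : ∀ v → degree G v ≡ ∑ D (λ p → ∑ L (λ u → edgeOcc G v u (verts p)))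
      degree≡∑edgeOcc v = begin
        degree G v                                         ≡⟨ length-filter≡∑𝟙 (adj? G v) L ⟩
        ∑ L (λ u → 𝟙 (adj? G v u))                         ≡⟨ ∑-cong L edges-at ⟩
        ∑ L (λ u → ∑ D (λ p → edgeOcc G v u (verts p)))    ≡⟨ ∑-comm L D (λ u p → edgeOcc G v u (verts p)) ⟩
        ∑ D (λ p → ∑ L (λ u → edgeOcc G v u (verts p)))    ∎
        where
        open ≡-Reasoning
        edges-at : ∀ u → 𝟙 (adj? G v u) ≡ ∑ D (λ p → edgeOcc G v u (verts p))
        edges-at u with adj? G v u
        ... | yes vu = sym (isD v u vu)
        ... | no ¬vu = sym (trans (∑-cong D (λ p → edgeOcc-nonedge (verts p) (linked p) ¬vu)) (∑-zero D))

      degree-parity : ∀ v → degree G v + mult v (pathEnds D) ≡ 2 * ∑ D (λ p → mult v (verts p))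
      degree-parity v = begin
        degree G v + mult v (pathEnds D)
          ≡⟨ cong₂ _+_ (degree≡∑edgeOcc v) (∑-concatMap (λ p → endpoints (verts p)) D _) ⟩
        ∑ D (λ p → ∑ L (λ u → edgeOcc G v u (verts p))) + ∑ D (λ p → mult v (endpoints (verts p)))
          ≡⟨ sym (∑-+ D _ _) ⟩
        ∑ D (λ p → ∑ L (λ u → edgeOcc G v u (verts p)) + mult v (endpoints (verts p)))
          ≡⟨ ∑-cong D (λ p → edgeOcc-degree v (verts p) (linked p)) ⟩
        ∑ D (λ p → 2 * mult v (verts p))
          ≡⟨ ∑-*ˡ D 2 _ ⟩
        2 * ∑ D (λ p → mult v (verts p))
          ∎
        where open ≡-Reasoning

      private
        visits : V G → ℕ
        visits v = ∑ D (λ p → mult v (verts p))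

        odd : V G → ℕ
        odd v = 𝟙 ((degree G v % 2) ≟ℕ 1)

        n-odd≡∑ : n-odd G ≡ ∑ L odd
        n-odd≡∑ = length-filter≡∑𝟙 (λ v → (degree G v % 2) ≟ℕ 1) L

        ∑-ends : ∑ L (λ v → mult v (pathEnds D)) ≡ length D * 2
        ∑-ends = trans (∑-multiplicity _≟_ L (pathEnds D) enum) (length-pathEnds D)

      n-odd≤ : n-odd G ≤ length D * 2
      n-odd≤ = begin
        n-odd G                          ≡⟨ n-odd≡∑ ⟩
        ∑ L odd                          ≤⟨ ∑-mono L (λ v → 𝟙-odd≤ (degree G v) _ (visits v) (degree-parity v)) ⟩
        ∑ L (λ v → mult v (pathEnds D))  ≡⟨ ∑-ends ⟩
        length D * 2                     ∎
        where open ≤-Reasoning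

      n-odd≡ : Unique (pathEnds D) → n-odd G ≡ length D * 2
      n-odd≡ uniq = begin
        n-odd G                          ≡⟨ n-odd≡∑ ⟩
        ∑ L odd                          ≡⟨ ∑-cong L (λ v → 𝟙-odd≡ (degree G v) _ (visits v) (degree-parity v)
                                                              (multiplicity-unique _≟_ (pathEnds D) uniq)) ⟩
        ∑ L (λ v → mult v (pathEnds D))  ≡⟨ ∑-ends ⟩
        length D * 2                     ∎
        where open ≡-Reasoning

    pathNumber-by-ends : (D : PathDecomposition G) → Unique (pathEnds (proj₁ D)) → PathNumberIs G (n-odd G / 2)
    pathNumber-by-ends (D , isD) uniq = ((D , isD) , sym n-odd/2≡) , minimal
      where
      n-odd/2≡ : n-odd G / 2 ≡ length D
      n-odd/2≡ = trans (cong (_/ 2) (n-odd≡ D isD uniq)) (m*n/n≡m (length D) 2)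
      minimal : ∀ (D′ : PathDecomposition G) → n-odd G / 2 ≤ length (proj₁ D′)
      minimal (D′ , isD′) = subst (n-odd G / 2 ≤_) (m*n/n≡m (length D′) 2) (/-monoˡ-≤ 2 (n-odd≤ D′ isD′))

module _ {G H : Graph} (f : V G → V H) (f-inj : ∀ {x y} → f x ≡ f y → x ≡ y) where

  isEdge-map : ∀ u v a b → isEdge G u v a b ≡ isEdge H (f u) (f v) (f a) (f b)
  isEdge-map u v a b = isEdge-cong G H u v a b (f u) (f v) (f a) (f b)
    (Sum.map (Product.map (cong f) (cong f)) (Product.map (cong f) (cong f)))
    (Sum.map (Product.map f-inj f-inj) (Product.map f-inj f-inj))

  edgeOcc-map : ∀ u v xs → edgeOcc G u v xs ≡ edgeOcc H (f u) (f v) (map f xs)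
  edgeOcc-map u v []           = refl
  edgeOcc-map u v (a ∷ [])     = refl
  edgeOcc-map u v (a ∷ b ∷ ys) = cong₂ _+_ (isEdge-map u v a b) (edgeOcc-map u v (b ∷ ys))

-- The grid ℕ × ℕ and decompositions of boxes

-- Only adjacency and decidable equality of these infinite graphs are ever used; their vertex lists are left empty.
ℕ-path : Graph
ℕ-path = record
  { V        = ℕ
  ; _≟V_     = _≟ℕ_
  ; vertices = []
  ; Adj      = λ i j → suc i ≡ j ⊎ suc j ≡ i
  ; adj?     = λ i j → (suc i ≟ℕ j) ⊎-dec (suc j ≟ℕ i)
  ; symm     = Sum.swap
  ; irrefl   = λ { (inj₁ e) → 1+n≢n e ; (inj₂ e) → 1+n≢n e }
  }

ℕ² : Graph
ℕ² = ℕ-path □ ℕ-path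

InBox : ℕ → ℕ → ℕ × ℕ → Set
InBox n t x = proj₁ x < n × proj₂ x < t

IsBoxPath : ℕ → ℕ → List (ℕ × ℕ) → Set
IsBoxPath n t xs = All (InBox n t) xs × 2 ≤ length xs × Unique xs × Linked (Adj ℕ²) xs

record BoxDecomposition (n t : ℕ) : Set where
  field
    paths      : List (List (ℕ × ℕ))
    boxPaths   : All (IsBoxPath n t) paths
    covers     : ∀ u v → InBox n t u → InBox n t v → Adj ℕ² u v → ∑ paths (edgeOcc ℕ² u v) ≡ 1
    endsUnique : Unique (concatMap endpoints paths)

module _ {n t : ℕ} where
  private
    Grid : Graph
    Grid = P n □ P t

  toℕ² : Fin n × Fin t → ℕ × ℕ
  toℕ² = Product.map toℕ toℕ

  toℕ²-injective : ∀ {x y} → toℕ² x ≡ toℕ² y → x ≡ y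
  toℕ²-injective e = cong₂ _,_ (toℕ-injective (cong proj₁ e)) (toℕ-injective (cong proj₂ e))

  adj-toℕ²⁺ : ∀ {x y} → Adj Grid x y → Adj ℕ² (toℕ² x) (toℕ² y)
  adj-toℕ²⁺ (inj₁ (ij , e)) = inj₁ (ij , cong toℕ e)
  adj-toℕ²⁺ (inj₂ (e , ij)) = inj₂ (cong toℕ e , ij)

  adj-toℕ²⁻ : ∀ {x y} → Adj ℕ² (toℕ² x) (toℕ² y) → Adj Grid x y
  adj-toℕ²⁻ (inj₁ (ij , e)) = inj₁ (ij , toℕ-injective e)
  adj-toℕ²⁻ (inj₂ (e , ij)) = inj₂ (toℕ-injective e , ij)

  enumerates-grid : EnumeratesVertices Grid
  enumerates-grid (i , j) = multiplicity-unique-∈ (_≟V_ Grid) (vertices Grid)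
    (Unique.cartesianProduct⁺ (Unique.allFin⁺ n) (Unique.allFin⁺ t))
    (∈-cartesianProduct⁺ (∈-allFin i) (∈-allFin j))

  fromBox : (xs : List (ℕ × ℕ)) → All (InBox n t) xs → List (Fin n × Fin t)
  fromBox []       []                 = []
  fromBox (_ ∷ xs) ((r< , c<) ∷ inBox) = (fromℕ< r< , fromℕ< c<) ∷ fromBox xs inBox

  toℕ²-fromBox : ∀ xs (inBox : All (InBox n t) xs) → map toℕ² (fromBox xs inBox) ≡ xs
  toℕ²-fromBox []       []                 = refl
  toℕ²-fromBox (_ ∷ xs) ((r< , c<) ∷ inBox) =
    cong₂ _∷_ (cong₂ _,_ (toℕ-fromℕ< r<) (toℕ-fromℕ< c<)) (toℕ²-fromBox xs inBox)

  toPath : (xs : List (ℕ × ℕ)) → IsBoxPath n t xs → Path Grid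
  toPath xs (inBox , 2≤len , uniq , lk) = record
    { verts    = ys
    ; nontriv  = subst (2 ≤_) (trans (cong length (sym ys≡)) (length-map toℕ² ys)) 2≤len
    ; distinct = Unique.map⁻ (subst Unique (sym ys≡) uniq)
    ; linked   = Linked.map adj-toℕ²⁻ (Linked.map⁻ (subst (Linked (Adj ℕ²)) (sym ys≡) lk))
    }
    where ys : List (Fin n × Fin t)
          ys = fromBox xs inBox
          ys≡ : map toℕ² ys ≡ xs
          ys≡ = toℕ²-fromBox xs inBox

  toPaths : (ps : List (List (ℕ × ℕ))) → All (IsBoxPath n t) ps → List (Path Grid)
  toPaths []       []               = []
  toPaths (xs ∷ ps) (isPath ∷ areP) = toPath xs isPath ∷ toPaths ps areP

  toℕ²-toPaths : ∀ ps (areP : All (IsBoxPath n t) ps) → map (λ p → map toℕ² (verts p)) (toPaths ps areP) ≡ ps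
  toℕ²-toPaths []        []                         = refl
  toℕ²-toPaths (xs ∷ ps) ((inBox , _) ∷ areP) = cong₂ _∷_ (toℕ²-fromBox xs inBox) (toℕ²-toPaths ps areP)

  pathNumber-from-box : BoxDecomposition n t → PathNumberIs Grid (n-odd Grid / 2)
  pathNumber-from-box box = pathNumber-by-ends Grid enumerates-grid (D , isD) ends-unique
    where
    open BoxDecomposition box
    D : List (Path Grid)
    D = toPaths paths boxPaths
    images : map (λ p → map toℕ² (verts p)) D ≡ paths
    images = toℕ²-toPaths paths boxPaths
    isD : IsPathDecomposition Grid D
    isD u v uv = begin
      ∑ D (λ p → edgeOcc Grid u v (verts p))
        ≡⟨ ∑-cong D (λ p → edgeOcc-map toℕ² toℕ²-injective u v (verts p)) ⟩
      ∑ D (λ p → edgeOcc ℕ² (toℕ² u) (toℕ² v) (map toℕ² (verts p)))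
        ≡⟨ sym (∑-map (λ p → map toℕ² (verts p)) D _) ⟩
      ∑ (map (λ p → map toℕ² (verts p)) D) (edgeOcc ℕ² (toℕ² u) (toℕ² v))
        ≡⟨ cong (λ qs → ∑ qs (edgeOcc ℕ² (toℕ² u) (toℕ² v))) images ⟩
      ∑ paths (edgeOcc ℕ² (toℕ² u) (toℕ² v))
        ≡⟨ covers (toℕ² u) (toℕ² v) (inBox u) (inBox v) (adj-toℕ²⁺ uv) ⟩
      1 ∎
      where open ≡-Reasoning
            inBox : ∀ x → InBox n t (toℕ² x)
            inBox (i , j) = toℕ<n i , toℕ<n j
    ends≡ : map toℕ² (pathEnds D) ≡ concatMap endpoints paths
    ends≡ = trans (map-concatMap-endpoints toℕ² verts D) (cong (concatMap endpoints) images)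
    ends-unique : Unique (pathEnds D)
    ends-unique = Unique.map⁻ (subst Unique (sym ends≡) endsUnique)

swap-injective : ∀ {x y : ℕ × ℕ} → swap x ≡ swap y → x ≡ y
swap-injective = cong swap

adj-swap : ∀ {x y} → Adj ℕ² x y → Adj ℕ² (swap x) (swap y)
adj-swap (inj₁ (ij , e)) = inj₂ (e , ij)
adj-swap (inj₂ (e , ij)) = inj₁ (ij , e)

isBoxPath-swap : ∀ {n t xs} → IsBoxPath t n xs → IsBoxPath n t (map swap xs)
isBoxPath-swap {xs = xs} (inBox , 2≤len , uniq , lk) =
  All.map⁺ (All.map Product.swap inBox) , subst (2 ≤_) (sym (length-map swap xs)) 2≤len ,
  Unique.map⁺ swap-injective uniq , Linked.map⁺ (Linked.map adj-swap lk)

swapBox : ∀ {n t} → BoxDecomposition t n → BoxDecomposition n t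
swapBox {n} {t} box = record
  { paths      = map (map swap) paths
  ; boxPaths   = All.map⁺ (All.map isBoxPath-swap boxPaths)
  ; covers     = covers′
  ; endsUnique = subst Unique (map-concatMap-endpoints swap (λ p → p) paths) (Unique.map⁺ swap-injective endsUnique)
  }
  where
  open BoxDecomposition box
  covers′ : ∀ u v → InBox n t u → InBox n t v → Adj ℕ² u v → ∑ (map (map swap) paths) (edgeOcc ℕ² u v) ≡ 1
  covers′ u v u∈ v∈ uv = begin
    ∑ (map (map swap) paths) (edgeOcc ℕ² u v)        ≡⟨ ∑-map (map swap) paths _ ⟩
    ∑ paths (λ p → edgeOcc ℕ² u v (map swap p))       ≡⟨ ∑-cong paths (λ p → edgeOcc-map swap swap-injective (swap u) (swap v) p) ⟨
    ∑ paths (edgeOcc ℕ² (swap u) (swap v))            ≡⟨ covers (swap u) (swap v) (Product.swap u∈) (Product.swap v∈) (adj-swap uv) ⟩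
    1                                                 ∎
    where open ≡-Reasoning

-- Covering a box by counting

beside below : ℕ × ℕ → ℕ × ℕ
beside x = proj₁ x , suc (proj₂ x)
below  x = suc (proj₁ x) , proj₂ x

private
  _≟²_ : DecidableEquality (ℕ × ℕ)
  _≟²_ = _≟V_ ℕ²

module _ (s : ℕ × ℕ → ℕ × ℕ) where

  isEdge-same-direction : (∀ z → s (s z) ≢ z) → ∀ z a → isEdge ℕ² z (s z) a (s a) ≡ 𝟙 (z ≟² a)
  isEdge-same-direction s²≢ z a = trans (isEdge≡𝟙 ℕ² z (s z) a (s a)) (𝟙-cong to from (traverses? ℕ² z (s z) a (s a)) (z ≟² a))
    where to : (a ≡ z × s a ≡ s z) ⊎ (a ≡ s z × s a ≡ z) → z ≡ a
          to (inj₁ (a≡z , _))  = sym a≡z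
          to (inj₂ (refl , e)) = ⊥-elim (s²≢ z e)
          from : z ≡ a → (a ≡ z × s a ≡ s z) ⊎ (a ≡ s z × s a ≡ z)
          from refl = inj₁ (refl , refl)

  isEdge-other-direction : (s′ : ℕ × ℕ → ℕ × ℕ) → (∀ z → s′ z ≢ s z) → (∀ z → s′ (s z) ≢ z) →
                           ∀ z a → isEdge ℕ² z (s z) a (s′ a) ≡ 0
  isEdge-other-direction s′ s′≢s s′s≢ z a = isEdge-no ℕ² z (s z) a (s′ a) impossible
    where impossible : ¬ Traverses ℕ² z (s z) a (s′ a)
          impossible (inj₁ (refl , e)) = s′≢s z e
          impossible (inj₂ (refl , e)) = s′s≢ z e

isEdge-beside-beside : ∀ z a → isEdge ℕ² z (beside z) a (beside a) ≡ 𝟙 (z ≟² a)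
isEdge-beside-beside = isEdge-same-direction beside (λ z e → m+1+n≢n 1 (cong proj₂ e))

isEdge-below-below : ∀ z a → isEdge ℕ² z (below z) a (below a) ≡ 𝟙 (z ≟² a)
isEdge-below-below = isEdge-same-direction below (λ z e → m+1+n≢n 1 (cong proj₁ e))

isEdge-beside-below : ∀ z a → isEdge ℕ² z (beside z) a (below a) ≡ 0
isEdge-beside-below = isEdge-other-direction beside below (λ z e → 1+n≢n (cong proj₁ e)) (λ z e → 1+n≢n (cong proj₁ e))

isEdge-below-beside : ∀ z a → isEdge ℕ² z (below z) a (beside a) ≡ 0
isEdge-below-beside = isEdge-other-direction below beside (λ z e → 1+n≢n (cong proj₂ e)) (λ z e → 1+n≢n (cong proj₂ e))

cells : ℕ → ℕ → List (ℕ × ℕ)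
cells n t = cartesianProduct (upTo n) (upTo t)

length-cells : ∀ n t → length (cells n t) ≡ n * t
length-cells n t = trans (length-cartesianProduct (upTo n) (upTo t)) (cong₂ _*_ (length-upTo n) (length-upTo t))
  where
  length-cartesianProduct : ∀ {A B : Set} (xs : List A) (ys : List B) → length (cartesianProduct xs ys) ≡ length xs * length ys
  length-cartesianProduct []       ys = refl
  length-cartesianProduct (x ∷ xs) ys =
    trans (length-++ (map (x ,_) ys)) (cong₂ _+_ (length-map (x ,_) ys) (length-cartesianProduct xs ys))

∈-cells⁺ : ∀ {n t x} → InBox n t x → x ∈ cells n t
∈-cells⁺ (r< , c<) = ∈-cartesianProduct⁺ (∈-upTo⁺ r<) (∈-upTo⁺ c<)

∈-cells⁻ : ∀ {n t x} → x ∈ cells n t → InBox n t x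
∈-cells⁻ {n} {t} x∈ = Product.map ∈-upTo⁻ ∈-upTo⁻ (∈-cartesianProduct⁻ (upTo n) (upTo t) x∈)

multiplicity-cells : ∀ {n t x} → InBox n t x → multiplicity _≟²_ x (cells n t) ≡ 1
multiplicity-cells {n} {t} x∈ = multiplicity-unique-∈ _≟²_ (cells n t) (Unique.cartesianProduct⁺ (Unique.upTo⁺ n) (Unique.upTo⁺ t)) (∈-cells⁺ x∈)

boxEdges : ℕ → ℕ → List ((ℕ × ℕ) × (ℕ × ℕ))
boxEdges n t = map (λ x → x , beside x) (cells n (pred t)) ++ map (λ x → x , below x) (cells (pred n) t)

length-boxEdges : ∀ n t → length (boxEdges n t) ≡ n * pred t + pred n * t
length-boxEdges n t = begin
  length (boxEdges n t)
    ≡⟨ length-++ (map (λ x → x , beside x) (cells n (pred t))) ⟩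
  length (map (λ x → x , beside x) (cells n (pred t))) + length (map (λ x → x , below x) (cells (pred n) t))
    ≡⟨ cong₂ _+_ (length-map _ (cells n (pred t))) (length-map _ (cells (pred n) t)) ⟩
  length (cells n (pred t)) + length (cells (pred n) t)
    ≡⟨ cong₂ _+_ (length-cells n (pred t)) (length-cells (pred n) t) ⟩
  n * pred t + pred n * t
    ∎
  where open ≡-Reasoning

<pred⇒suc< : ∀ {y} t → y < pred t → suc y < t
<pred⇒suc< (suc t) y<t = s≤s y<t

module _ {n t : ℕ} where
  private
    crossings : ℕ × ℕ → ℕ × ℕ → (ℕ × ℕ) × (ℕ × ℕ) → ℕ
    crossings a b e = isEdge ℕ² (proj₁ e) (proj₂ e) a b
    horizontal vertical : List (ℕ × ℕ)
    horizontal = cells n (pred t)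
    vertical   = cells (pred n) t

  ∈-boxEdges-beside : ∀ {x} → InBox n t x → InBox n t (beside x) → (x , beside x) ∈ boxEdges n t
  ∈-boxEdges-beside (r< , _) (_ , c+1<) = ∈-++⁺ˡ (∈-map⁺ _ (∈-cells⁺ (r< , <⇒≤pred c+1<)))

  ∈-boxEdges-below : ∀ {x} → InBox n t x → InBox n t (below x) → (x , below x) ∈ boxEdges n t
  ∈-boxEdges-below (_ , c<) (r+1< , _) = ∈-++⁺ʳ _ (∈-map⁺ _ (∈-cells⁺ (<⇒≤pred r+1< , c<)))

  ∑-boxEdges : ∀ g → ∑ (boxEdges n t) g ≡ ∑ horizontal (λ z → g (z , beside z)) + ∑ vertical (λ z → g (z , below z))
  ∑-boxEdges g = trans (∑-++ (map (λ x → x , beside x) horizontal) _ g) (cong₂ _+_ (∑-map _ horizontal g) (∑-map _ vertical g))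

  ∑-boxEdges-beside : ∀ a → InBox n t a → InBox n t (beside a) → ∑ (boxEdges n t) (crossings a (beside a)) ≡ 1
  ∑-boxEdges-beside a (r< , _) (_ , c+1<) = begin
    ∑ (boxEdges n t) (crossings a (beside a))
      ≡⟨ ∑-boxEdges (crossings a (beside a)) ⟩
    ∑ horizontal (λ z → isEdge ℕ² z (beside z) a (beside a)) + ∑ vertical (λ z → isEdge ℕ² z (below z) a (beside a))
      ≡⟨ cong₂ _+_ (∑-cong horizontal (λ z → isEdge-beside-beside z a)) (∑-cong vertical (λ z → isEdge-below-beside z a)) ⟩
    multiplicity _≟²_ a horizontal + ∑ vertical (λ _ → 0)
      ≡⟨ cong₂ _+_ (multiplicity-cells (r< , <⇒≤pred c+1<)) (∑-zero vertical) ⟩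
    1 ∎
    where open ≡-Reasoning

  ∑-boxEdges-below : ∀ a → InBox n t a → InBox n t (below a) → ∑ (boxEdges n t) (crossings a (below a)) ≡ 1
  ∑-boxEdges-below a (_ , c<) (r+1< , _) = begin
    ∑ (boxEdges n t) (crossings a (below a))
      ≡⟨ ∑-boxEdges (crossings a (below a)) ⟩
    ∑ horizontal (λ z → isEdge ℕ² z (beside z) a (below a)) + ∑ vertical (λ z → isEdge ℕ² z (below z) a (below a))
      ≡⟨ cong₂ _+_ (∑-cong horizontal (λ z → isEdge-beside-below z a)) (∑-cong vertical (λ z → isEdge-below-below z a)) ⟩
    ∑ horizontal (λ _ → 0) + multiplicity _≟²_ a vertical
      ≡⟨ cong₂ _+_ (∑-zero horizontal) (multiplicity-cells (<⇒≤pred r+1< , c<)) ⟩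
    1 ∎
    where open ≡-Reasoning

  ∑-boxEdges-step : ∀ a b → InBox n t a → InBox n t b → Adj ℕ² a b → ∑ (boxEdges n t) (crossings a b) ≡ 1
  ∑-boxEdges-step a b a∈ b∈ (inj₁ (inj₁ refl , refl)) = ∑-boxEdges-below a a∈ b∈
  ∑-boxEdges-step a b a∈ b∈ (inj₂ (refl , inj₁ refl)) = ∑-boxEdges-beside a a∈ b∈
  ∑-boxEdges-step a b a∈ b∈ (inj₁ (inj₂ refl , refl)) =
    trans (∑-cong (boxEdges n t) (λ e → isEdge-symʳ ℕ² (proj₁ e) (proj₂ e) a b)) (∑-boxEdges-below b b∈ a∈)
  ∑-boxEdges-step a b a∈ b∈ (inj₂ (refl , inj₂ refl)) =
    trans (∑-cong (boxEdges n t) (λ e → isEdge-symʳ ℕ² (proj₁ e) (proj₂ e) a b)) (∑-boxEdges-beside b b∈ a∈)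

  ∑-boxEdges-edgeOcc : ∀ xs → All (InBox n t) xs → Linked (Adj ℕ²) xs →
                       ∑ (boxEdges n t) (λ e → edgeOcc ℕ² (proj₁ e) (proj₂ e) xs) ≡ length xs ∸ 1
  ∑-boxEdges-edgeOcc []           _                  _         = ∑-zero (boxEdges n t)
  ∑-boxEdges-edgeOcc (a ∷ [])     _                  _         = ∑-zero (boxEdges n t)
  ∑-boxEdges-edgeOcc (a ∷ b ∷ ys) (a∈ ∷ b∈ ∷ inBox) (ab ∷ lk) =
    trans (∑-+ (boxEdges n t) (crossings a b) _)
          (cong₂ _+_ (∑-boxEdges-step a b a∈ b∈ ab) (∑-boxEdges-edgeOcc (b ∷ ys) (b∈ ∷ inBox) lk))

  -- The paths traverse exactly as many steps as the box has edges, and each edge at least once.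
  covers-by-counting : ∀ ps → All (IsBoxPath n t) ps →
    (∀ x → InBox n t x → InBox n t (beside x) → 1 ≤ ∑ ps (edgeOcc ℕ² x (beside x))) →
    (∀ x → InBox n t x → InBox n t (below x) → 1 ≤ ∑ ps (edgeOcc ℕ² x (below x))) →
    ∑ ps (λ p → length p ∸ 1) ≡ n * pred t + pred n * t →
    ∀ u v → InBox n t u → InBox n t v → Adj ℕ² u v → ∑ ps (edgeOcc ℕ² u v) ≡ 1
  covers-by-counting ps areP horizontal-covered vertical-covered steps = cover
    where
    load : (ℕ × ℕ) × (ℕ × ℕ) → ℕ
    load e = ∑ ps (edgeOcc ℕ² (proj₁ e) (proj₂ e))

    ∑-load : ∑ (boxEdges n t) load ≡ length (boxEdges n t)
    ∑-load = begin
      ∑ (boxEdges n t) load                                                  ≡⟨ ∑-comm (boxEdges n t) ps _ ⟩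
      ∑ ps (λ p → ∑ (boxEdges n t) (λ e → edgeOcc ℕ² (proj₁ e) (proj₂ e) p)) ≡⟨ ∑-boxPaths ps areP ⟩
      ∑ ps (λ p → length p ∸ 1)                                              ≡⟨ steps ⟩
      n * pred t + pred n * t                                                ≡⟨ length-boxEdges n t ⟨
      length (boxEdges n t)                                                  ∎
      where
      open ≡-Reasoning
      ∑-boxPaths : ∀ qs → All (IsBoxPath n t) qs →
        ∑ qs (λ p → ∑ (boxEdges n t) (λ e → edgeOcc ℕ² (proj₁ e) (proj₂ e) p)) ≡ ∑ qs (λ p → length p ∸ 1)
      ∑-boxPaths []       []                           = refl
      ∑-boxPaths (q ∷ qs) ((inBox , _ , _ , lk) ∷ areQ) =
        cong₂ _+_ (∑-boxEdges-edgeOcc q inBox lk) (∑-boxPaths qs areQ)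

    load≥1 : ∀ e → e ∈ boxEdges n t → 1 ≤ load e
    load≥1 e e∈ with ∈-++⁻ (map (λ x → x , beside x) horizontal) e∈
    ... | inj₁ e∈horizontal with x , x∈ , refl ← ∈-map⁻ _ e∈horizontal =
      let (r< , c<) = ∈-cells⁻ x∈ in horizontal-covered x (r< , <-trans (n<1+n _) (<pred⇒suc< t c<)) (r< , <pred⇒suc< t c<)
    ... | inj₂ e∈vertical with x , x∈ , refl ← ∈-map⁻ _ e∈vertical =
      let (r< , c<) = ∈-cells⁻ x∈ in vertical-covered x (<-trans (n<1+n _) (<pred⇒suc< n r<) , c<) (<pred⇒suc< n r< , c<)

    load≡1 : ∀ e → e ∈ boxEdges n t → load e ≡ 1
    load≡1 = ∑≡length⇒≡1 load (boxEdges n t) load≥1 ∑-load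

    cover : ∀ u v → InBox n t u → InBox n t v → Adj ℕ² u v → ∑ ps (edgeOcc ℕ² u v) ≡ 1
    cover u v u∈ v∈ (inj₁ (inj₁ refl , refl)) = load≡1 _ (∈-boxEdges-below u∈ v∈)
    cover u v u∈ v∈ (inj₂ (refl , inj₁ refl)) = load≡1 _ (∈-boxEdges-beside u∈ v∈)
    cover u v u∈ v∈ (inj₁ (inj₂ refl , refl)) =
      trans (∑-cong ps (edgeOcc-symˡ ℕ² u v)) (load≡1 _ (∈-boxEdges-below v∈ u∈))
    cover u v u∈ v∈ (inj₂ (refl , inj₂ refl)) =
      trans (∑-cong ps (edgeOcc-symˡ ℕ² u v)) (load≡1 _ (∈-boxEdges-beside v∈ u∈))

-- Explicit decompositions

row : ℕ → ℕ → List (ℕ × ℕ)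
row t r = applyUpTo (r ,_) t

columnDown columnUp : ℕ → ℕ → List (ℕ × ℕ)
columnDown n c = applyUpTo (_, c) n
columnUp   n c = applyDownFrom (_, c) n

module _ {n t : ℕ} where

  row-inBox : ∀ {r} → r < n → All (InBox n t) (row t r)
  row-inBox r< = All.applyUpTo⁺₁ _ t (λ c< → r< , c<)

  columnDown-inBox : ∀ {c} → c < t → All (InBox n t) (columnDown n c)
  columnDown-inBox c< = All.applyUpTo⁺₁ _ n (λ r< → r< , c<)

  columnUp-inBox : ∀ {c} → c < t → All (InBox n t) (columnUp n c)
  columnUp-inBox c< = All.applyDownFrom⁺₁ _ n (λ r< → r< , c<)

row-inRow : ∀ t r → All (λ x → proj₁ x ≡ r) (row t r)
row-inRow t r = All.applyUpTo⁺₂ _ t (λ _ → refl)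

columnDown-inColumn : ∀ n c → All (λ x → proj₂ x ≡ c) (columnDown n c)
columnDown-inColumn n c = All.applyUpTo⁺₂ _ n (λ _ → refl)

columnUp-inColumn : ∀ n c → All (λ x → proj₂ x ≡ c) (columnUp n c)
columnUp-inColumn n c = All.applyDownFrom⁺₂ _ n (λ _ → refl)

row-unique : ∀ t r → Unique (row t r)
row-unique t r = Unique.applyUpTo⁺₁ _ t (λ i<j _ e → <⇒≢ i<j (cong proj₂ e))

columnDown-unique : ∀ n c → Unique (columnDown n c)
columnDown-unique n c = Unique.applyUpTo⁺₁ _ n (λ i<j _ e → <⇒≢ i<j (cong proj₁ e))

columnUp-unique : ∀ n c → Unique (columnUp n c)
columnUp-unique n c = Unique.applyDownFrom⁺₁ _ n (λ j<i _ e → <⇒≢ j<i (sym (cong proj₁ e)))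

row-linked : ∀ t r → Linked (Adj ℕ²) (row t r)
row-linked t r = Linked.applyUpTo⁺₂ _ t (λ _ → inj₂ (refl , inj₁ refl))

columnDown-linked : ∀ n c → Linked (Adj ℕ²) (columnDown n c)
columnDown-linked n c = Linked.applyUpTo⁺₂ _ n (λ _ → inj₁ (inj₁ refl , refl))

columnUp-linked : ∀ n c → Linked (Adj ℕ²) (columnUp n c)
columnUp-linked n c = Linked.applyDownFrom⁺₂ _ n (λ _ → inj₁ (inj₂ refl , refl))

covered-by : ∀ ps u v {p} → p ∈ ps → Consecutive u v p ⊎ Consecutive v u p → 1 ≤ ∑ ps (edgeOcc ℕ² u v)
covered-by ps u v p∈ps (inj₁ uv) = ≤-trans (consecutive⇒edgeOcc ℕ² uv) (∑-∈ (edgeOcc ℕ² u v) p∈ps)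
covered-by ps u v p∈ps (inj₂ vu) = ≤-trans (consecutive⇒edgeOcc′ ℕ² vu) (∑-∈ (edgeOcc ℕ² u v) p∈ps)

rowDecomposition : ∀ T → BoxDecomposition 1 (2 + T)
rowDecomposition T = record
  { paths      = path ∷ []
  ; boxPaths   = isPath ∷ []
  ; covers     = covers-by-counting (path ∷ []) (isPath ∷ []) horizontal-covered vertical-covered steps
  ; endsUnique = subst Unique (cong (λ z → (0 , 0) ∷ z ∷ []) (sym (lastOf-applyUpTo (0 ,_) (suc T))))
                       (((λ ()) ∷ []) ∷ [] ∷ [])
  }
  where
  t : ℕ
  t = 2 + T
  path : List (ℕ × ℕ)
  path = row t 0
  isPath : IsBoxPath 1 t path
  isPath = row-inBox (s≤s z≤n) , s≤s (s≤s z≤n) , row-unique t 0 , row-linked t 0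
  horizontal-covered : ∀ x → InBox 1 t x → InBox 1 t (beside x) → 1 ≤ ∑ (path ∷ []) (edgeOcc ℕ² x (beside x))
  horizontal-covered (suc _ , _) (s≤s () , _) _
  horizontal-covered (zero , c) _ (_ , c+1<) = covered-by (path ∷ []) (0 , c) (0 , suc c) (here refl) (inj₁ (consecutive-applyUpTo (0 ,_) c+1<))
  vertical-covered : ∀ x → InBox 1 t x → InBox 1 t (below x) → 1 ≤ ∑ (path ∷ []) (edgeOcc ℕ² x (below x))
  vertical-covered x _ (s≤s () , _)
  steps : ∑ (path ∷ []) (λ p → length p ∸ 1) ≡ 1 * pred t + pred 1 * t
  steps = trans (cong (λ m → m ∸ 1 + 0) (length-applyUpTo (0 ,_) t)) (cong (_+ 0) (sym (+-identityʳ (suc T))))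

data ColumnOf (T′ : ℕ) : ℕ → Set where
  first      : ColumnOf T′ 0
  dropColumn : ∀ {s} → s < T′ → ColumnOf T′ (1 + s)
  turnUp     : ColumnOf T′ (1 + T′)
  turnDown   : ColumnOf T′ (2 + T′)
  final      : ColumnOf T′ (3 + T′)

columnOf : ∀ T′ c → c < 4 + T′ → ColumnOf T′ c
columnOf T′       zero                    _ = first
columnOf zero     (suc zero)              _ = turnUp
columnOf zero     (suc (suc zero))        _ = turnDown
columnOf zero     (suc (suc (suc zero)))  _ = final
columnOf zero     (suc (suc (suc (suc c)))) (s≤s (s≤s (s≤s (s≤s ()))))
columnOf (suc T′) (suc c) (s≤s c<) = shift (columnOf T′ c c<)
  where
  shift : ∀ {c} → ColumnOf T′ c → ColumnOf (suc T′) (suc c)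
  shift first          = dropColumn (s≤s z≤n)
  shift (dropColumn s<) = dropColumn (s≤s s<)
  shift turnUp         = turnUp
  shift turnDown       = turnDown
  shift final          = final

-- The decomposition of a box with n = 2 + N′ rows and t = 4 + T′ columns (last row N, last column T):
--   hook      = (0,1) (0,0) | row 1 | (0,T) (0,T−1)
--   bracket s = (s+1,0) | row s+2 | (s+1,T)           for s < N′
--   drop s    = column s+1 upwards | (0,s+2)           for s < T′
--   turn      = column T′+1 upwards | column T′+2 downwards
-- Their ends are exactly the boundary vertices other than the corners, each once.
module LargeBox (N′ T′ : ℕ) where
  n t N T : ℕ
  n = 2 + N′
  t = 4 + T′
  N = 1 + N′
  T = 3 + T′

  hook : List (ℕ × ℕ)
  hook = (0 , 1) ∷ (0 , 0) ∷ row t 1 ++ (0 , T) ∷ (0 , 2 + T′) ∷ []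

  bracket : ℕ → List (ℕ × ℕ)
  bracket s = (1 + s , 0) ∷ row t (2 + s) ++ (1 + s , T) ∷ []

  drop : ℕ → List (ℕ × ℕ)
  drop s = columnUp n (1 + s) ++ (0 , 2 + s) ∷ []

  turn : List (ℕ × ℕ)
  turn = columnUp n (1 + T′) ++ columnDown n (2 + T′)

  paths : List (List (ℕ × ℕ))
  paths = hook ∷ map bracket (upTo N′) ++ map drop (upTo T′) ++ turn ∷ []

  private
    rowEnd : ∀ (r : ℕ) → lastOf (r , 0) (applyUpTo (λ c → r , suc c) T) ≡ (r , T)
    rowEnd r = lastOf-applyUpTo (λ c → r , c) T

    columnTop : ∀ (c : ℕ) → lastOf (N , c) (applyDownFrom (λ r → r , c) N) ≡ (0 , c)
    columnTop c = lastOf-applyDownFrom (λ r → r , c) N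

  hook-isPath : IsBoxPath n t hook
  hook-isPath = inBox , s≤s (s≤s z≤n) , uniq , linkage
    where
    inBox : All (InBox n t) hook
    inBox = (s≤s z≤n , s≤s (s≤s z≤n)) ∷ (s≤s z≤n , s≤s z≤n) ∷
            All.++⁺ (row-inBox (s≤s (s≤s z≤n))) ((s≤s z≤n , ≤-refl) ∷ (s≤s z≤n , s≤s (s≤s (s≤s (n≤1+n T′)))) ∷ [])
    uniq : Unique hook
    uniq = unique-++-separated (λ z → proj₁ z ≡ 0 × proj₂ z ≤ 1) {xs = (0 , 1) ∷ (0 , 0) ∷ []}
             (((λ ()) ∷ []) ∷ [] ∷ [])
             (unique-++-separated (λ z → proj₁ z ≡ 1) (row-unique t 1) ((((λ e → 1+n≢n (cong proj₂ e)) ∷ []) ∷ [] ∷ []))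
                (row-inRow t 1) ((λ ()) ∷ (λ ()) ∷ []))
             ((refl , s≤s z≤n) ∷ (refl , z≤n) ∷ [])
             (All.++⁺ (All.map (λ r≡1 (r≡0 , _) → 1+n≢0 (trans (sym r≡1) r≡0)) (row-inRow t 1))
                      ((λ { (_ , s≤s ()) }) ∷ (λ { (_ , s≤s ()) }) ∷ []))
    linkage : Linked (Adj ℕ²) hook
    linkage = inj₂ (refl , inj₂ refl) ∷ inj₁ (inj₁ refl , refl) ∷
              linked-join (1 , 0) _ (0 , T) _ (row-linked t 1)
                (subst (λ z → Adj ℕ² z (0 , T)) (sym (rowEnd 1)) (inj₁ (inj₂ refl , refl)))
                (inj₂ (refl , inj₂ refl) ∷ [-])

  bracket-isPath : ∀ {s} → s < N′ → IsBoxPath n t (bracket s)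
  bracket-isPath {s} s< = inBox , s≤s (s≤s z≤n) , uniq , linkage
    where
    s+2< : 2 + s < n
    s+2< = s≤s (s≤s s<)
    s+1< : 1 + s < n
    s+1< = <-trans (n<1+n _) s+2<
    inBox : All (InBox n t) (bracket s)
    inBox = (s+1< , s≤s z≤n) ∷ All.++⁺ (row-inBox s+2<) ((s+1< , ≤-refl) ∷ [])
    uniq : Unique (bracket s)
    uniq = All.++⁺ (all-≢ (λ e → 1+n≢n (sym e)) (row-inRow t (2 + s))) ((λ ()) ∷ [])
         ∷ unique-++-separated (λ z → proj₁ z ≡ 2 + s) (row-unique t (2 + s)) ([] ∷ [])
             (row-inRow t (2 + s)) ((λ e → 1+n≢n (sym e)) ∷ [])
    linkage : Linked (Adj ℕ²) (bracket s)
    linkage = inj₁ (inj₁ refl , refl) ∷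
              linked-join (2 + s , 0) _ (1 + s , T) [] (row-linked t (2 + s))
                (subst (λ z → Adj ℕ² z (1 + s , T)) (sym (rowEnd (2 + s))) (inj₁ (inj₂ refl , refl))) [-]

  drop-isPath : ∀ {s} → s < T′ → IsBoxPath n t (drop s)
  drop-isPath {s} s< = inBox , s≤s (1≤length-++-∷ (applyDownFrom _ N) _ []) , uniq , linkage
    where
    s+2< : 2 + s < t
    s+2< = s≤s (s≤s (<-trans s< (<-trans (n<1+n _) (n<1+n _))))
    inBox : All (InBox n t) (drop s)
    inBox = All.++⁺ (columnUp-inBox (<-trans (n<1+n _) s+2<)) ((s≤s z≤n , s+2<) ∷ [])
    uniq : Unique (drop s)
    uniq = unique-++-separated (λ z → proj₂ z ≡ 1 + s) (columnUp-unique n (1 + s)) ([] ∷ [])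
             (columnUp-inColumn n (1 + s)) ((λ e → 1+n≢n e) ∷ [])
    linkage : Linked (Adj ℕ²) (drop s)
    linkage = linked-join (N , 1 + s) _ (0 , 2 + s) [] (columnUp-linked n (1 + s))
                (subst (λ z → Adj ℕ² z (0 , 2 + s)) (sym (columnTop (1 + s))) (inj₂ (refl , inj₁ refl))) [-]

  turn-isPath : IsBoxPath n t turn
  turn-isPath = inBox , s≤s (1≤length-++-∷ (applyDownFrom _ N) _ _) , uniq , linkage
    where
    inBox : All (InBox n t) turn
    inBox = All.++⁺ (columnUp-inBox (s≤s (s≤s (m≤n+m T′ 2)))) (columnDown-inBox (s≤s (s≤s (s≤s (n≤1+n T′)))))
    uniq : Unique turn
    uniq = unique-++-separated (λ z → proj₂ z ≡ 1 + T′) (columnUp-unique n (1 + T′)) (columnDown-unique n (2 + T′))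
             (columnUp-inColumn n (1 + T′)) (All.map (λ c≡ c≡′ → 1+n≢n (trans (sym c≡) c≡′)) (columnDown-inColumn n (2 + T′)))
    linkage : Linked (Adj ℕ²) turn
    linkage = linked-join (N , 1 + T′) _ (0 , 2 + T′) _ (columnUp-linked n (1 + T′))
                (subst (λ z → Adj ℕ² z (0 , 2 + T′)) (sym (columnTop (1 + T′))) (inj₂ (refl , inj₁ refl)))
                (columnDown-linked n (2 + T′))

  areBoxPaths : All (IsBoxPath n t) paths
  areBoxPaths = hook-isPath ∷ All.++⁺ (all-map-upTo bracket N′ bracket-isPath)
                                      (All.++⁺ (all-map-upTo drop T′ drop-isPath) (turn-isPath ∷ []))

  private
    hook∈ : hook ∈ paths
    hook∈ = here refl

    bracket∈ : ∀ {s} → s < N′ → bracket s ∈ paths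
    bracket∈ s< = there (∈-++⁺ˡ (∈-map⁺ bracket (∈-upTo⁺ s<)))

    drop∈ : ∀ {s} → s < T′ → drop s ∈ paths
    drop∈ s< = there (∈-++⁺ʳ (map bracket (upTo N′)) (∈-++⁺ˡ (∈-map⁺ drop (∈-upTo⁺ s<))))

    turn∈ : turn ∈ paths
    turn∈ = there (∈-++⁺ʳ (map bracket (upTo N′)) (∈-++⁺ʳ (map drop (upTo T′)) (here refl)))

    covered : ∀ u v {p} → p ∈ paths → Consecutive u v p ⊎ Consecutive v u p → 1 ≤ ∑ paths (edgeOcc ℕ² u v)
    covered = covered-by paths

    columnTop-join : ∀ c y ys → Consecutive (0 , c) y (columnUp n c ++ y ∷ ys)
    columnTop-join c y ys = subst (λ z → Consecutive z y (columnUp n c ++ y ∷ ys)) (columnTop c)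
                              (consecutive-join (N , c) (applyDownFrom (λ r → r , c) N) y ys)

  hook-row : ∀ {c} → suc c < t → Consecutive (1 , c) (1 , suc c) hook
  hook-row c+1< = there (there (consecutive-++ˡ _ (consecutive-applyUpTo (1 ,_) c+1<)))

  hook-up : Consecutive (1 , T) (0 , T) hook
  hook-up = there (there (subst (λ z → Consecutive z (0 , T) (row t 1 ++ (0 , T) ∷ (0 , 2 + T′) ∷ [])) (rowEnd 1)
                            (consecutive-join (1 , 0) (applyUpTo (λ c → 1 , suc c) T) (0 , T) ((0 , 2 + T′) ∷ []))))

  hook-end : Consecutive (0 , T) (0 , 2 + T′) hook
  hook-end = there (there (consecutive-++ʳ (row t 1) here))

  bracket-row : ∀ {s c} → suc c < t → Consecutive (2 + s , c) (2 + s , suc c) (bracket s)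
  bracket-row {s} c+1< = there (consecutive-++ˡ _ (consecutive-applyUpTo (2 + s ,_) c+1<))

  bracket-up : ∀ s → Consecutive (2 + s , T) (1 + s , T) (bracket s)
  bracket-up s = there (subst (λ z → Consecutive z (1 + s , T) (row t (2 + s) ++ (1 + s , T) ∷ [])) (rowEnd (2 + s))
                          (consecutive-join (2 + s , 0) (applyUpTo (λ c → 2 + s , suc c) T) (1 + s , T) []))

  drop-column : ∀ {s r} → suc r < n → Consecutive (suc r , 1 + s) (r , 1 + s) (drop s)
  drop-column {s} r+1< = consecutive-++ˡ _ (consecutive-applyDownFrom (λ r → r , 1 + s) r+1<)

  drop-top : ∀ s → Consecutive (0 , 1 + s) (0 , 2 + s) (drop s)
  drop-top s = columnTop-join (1 + s) (0 , 2 + s) []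

  turn-up : ∀ {r} → suc r < n → Consecutive (suc r , 1 + T′) (r , 1 + T′) turn
  turn-up r+1< = consecutive-++ˡ _ (consecutive-applyDownFrom (λ r → r , 1 + T′) r+1<)

  turn-top : Consecutive (0 , 1 + T′) (0 , 2 + T′) turn
  turn-top = columnTop-join (1 + T′) (0 , 2 + T′) _

  turn-down : ∀ {r} → suc r < n → Consecutive (r , 2 + T′) (suc r , 2 + T′) turn
  turn-down r+1< = consecutive-++ʳ (columnUp n (1 + T′)) (consecutive-applyUpTo (λ r → r , 2 + T′) r+1<)

  horizontal-covered : ∀ x → InBox n t x → InBox n t (beside x) → 1 ≤ ∑ paths (edgeOcc ℕ² x (beside x))
  horizontal-covered (zero , c) _ (_ , c+1<) with columnOf T′ c (<-trans (n<1+n c) c+1<)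
  ... | first             = covered (0 , 0) (0 , 1) hook∈ (inj₂ here)
  ... | dropColumn {s} s< = covered (0 , 1 + s) (0 , 2 + s) (drop∈ s<) (inj₁ (drop-top s))
  ... | turnUp            = covered (0 , 1 + T′) (0 , 2 + T′) turn∈ (inj₁ turn-top)
  ... | turnDown          = covered (0 , 2 + T′) (0 , T) hook∈ (inj₂ hook-end)
  ... | final             = ⊥-elim (<-irrefl refl c+1<)
  horizontal-covered (1 , c) _ (_ , c+1<) = covered (1 , c) (1 , suc c) hook∈ (inj₁ (hook-row c+1<))
  horizontal-covered (suc (suc s) , c) (s+2< , _) (_ , c+1<) =
    covered (2 + s , c) (2 + s , suc c) (bracket∈ (≤-pred (≤-pred s+2<))) (inj₁ (bracket-row c+1<))

  vertical-covered : ∀ x → InBox n t x → InBox n t (below x) → 1 ≤ ∑ paths (edgeOcc ℕ² x (below x))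
  vertical-covered (r , c) (_ , c<) (r+1< , _) with columnOf T′ c c<
  vertical-covered (zero  , _) _ _ | first = covered (0 , 0) (1 , 0) hook∈ (inj₁ (there here))
  vertical-covered (suc s , _) _ (s+2< , _) | first = covered (1 + s , 0) (2 + s , 0) (bracket∈ (≤-pred (≤-pred s+2<))) (inj₁ here)
  vertical-covered (r , _) _ (r+1< , _) | dropColumn {s} s< = covered (r , 1 + s) (suc r , 1 + s) (drop∈ s<) (inj₂ (drop-column r+1<))
  vertical-covered (r , _) _ (r+1< , _) | turnUp   = covered (r , 1 + T′) (suc r , 1 + T′) turn∈ (inj₂ (turn-up r+1<))
  vertical-covered (r , _) _ (r+1< , _) | turnDown = covered (r , 2 + T′) (suc r , 2 + T′) turn∈ (inj₁ (turn-down r+1<))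
  vertical-covered (zero  , _) _ _ | final = covered (0 , T) (1 , T) hook∈ (inj₂ hook-up)
  vertical-covered (suc s , _) _ (s+2< , _) | final = covered (1 + s , T) (2 + s , T) (bracket∈ (≤-pred (≤-pred s+2<))) (inj₂ (bracket-up s))

  private
    steps-of : List (ℕ × ℕ) → ℕ
    steps-of p = length p ∸ 1

  steps : ∑ paths steps-of ≡ n * pred t + pred n * t
  steps = begin
    ∑ paths steps-of
      ≡⟨ cong (steps-of hook +_) (∑-++ (map bracket (upTo N′)) _ steps-of) ⟩
    steps-of hook + (∑ (map bracket (upTo N′)) steps-of + ∑ (map drop (upTo T′) ++ turn ∷ []) steps-of)
      ≡⟨ cong (λ m → steps-of hook + (∑ (map bracket (upTo N′)) steps-of + m)) (∑-++ (map drop (upTo T′)) _ steps-of) ⟩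
    steps-of hook + (∑ (map bracket (upTo N′)) steps-of + (∑ (map drop (upTo T′)) steps-of + (steps-of turn + 0)))
      ≡⟨ cong₂ (λ a b → steps-of hook + (a + (b + (steps-of turn + 0)))) (∑-family bracket N′ bracket-steps) (∑-family drop T′ drop-steps) ⟩
    steps-of hook + (N′ * (t + 1) + (T′ * (N + 1) + (steps-of turn + 0)))
      ≡⟨ cong₂ (λ a b → a + (N′ * (t + 1) + (T′ * (N + 1) + (b + 0)))) hook-steps turn-steps ⟩
    suc (t + 2) + (N′ * (t + 1) + (T′ * (N + 1) + ((N + n) + 0)))
      ≡⟨ arithmetic N′ T′ ⟩
    n * pred t + pred n * t
      ∎
    where
    open ≡-Reasoning
    ∑-family : ∀ (f : ℕ → List (ℕ × ℕ)) k {c} → (∀ s → steps-of (f s) ≡ c) → ∑ (map f (upTo k)) steps-of ≡ k * c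
    ∑-family f k {c} f-steps = begin
      ∑ (map f (upTo k)) steps-of    ≡⟨ ∑-map f (upTo k) steps-of ⟩
      ∑ (upTo k) (steps-of ∘ f)      ≡⟨ ∑-cong (upTo k) f-steps ⟩
      ∑ (upTo k) (λ _ → c)           ≡⟨ ∑-const (upTo k) c ⟩
      length (upTo k) * c            ≡⟨ cong (_* c) (length-upTo k) ⟩
      k * c                          ∎
    hook-steps : steps-of hook ≡ suc (t + 2)
    hook-steps = cong suc (trans (length-++ (row t 1)) (cong (_+ 2) (length-applyUpTo (1 ,_) t)))
    bracket-steps : ∀ s → steps-of (bracket s) ≡ t + 1
    bracket-steps s = trans (length-++ (row t (2 + s))) (cong (_+ 1) (length-applyUpTo (2 + s ,_) t))
    drop-steps : ∀ s → steps-of (drop s) ≡ N + 1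
    drop-steps s = cong (_∸ 1) (trans (length-++ (columnUp n (1 + s))) (cong (_+ 1) (length-applyDownFrom (_, 1 + s) n)))
    turn-steps : steps-of turn ≡ N + n
    turn-steps = cong (_∸ 1) (trans (length-++ (columnUp n (1 + T′))) (cong₂ _+_ (length-applyDownFrom (_, 1 + T′) n) (length-applyUpTo (_, 2 + T′) n)))
    arithmetic : ∀ a b → suc ((4 + b) + 2) + (a * ((4 + b) + 1) + (b * ((1 + a) + 1) + (((1 + a) + (2 + a)) + 0)))
                       ≡ (2 + a) * (3 + b) + (1 + a) * (4 + b)
    arithmetic = solve-∀

  private
    leftEnd rightEnd bottomEnd topEnd : ℕ → ℕ × ℕ
    leftEnd   s = 1 + s , 0
    rightEnd  s = 1 + s , T
    bottomEnd s = N , 1 + s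
    topEnd    s = 0 , 2 + s

    hookEnds turnEnds : List (ℕ × ℕ)
    hookEnds = (0 , 1) ∷ (0 , 2 + T′) ∷ []
    turnEnds = (N , 1 + T′) ∷ (N , 2 + T′) ∷ []

    family-ends : ∀ (f : ℕ → List (ℕ × ℕ)) (g h : ℕ → ℕ × ℕ) k → (∀ s → endpoints (f s) ≡ g s ∷ h s ∷ []) →
                  concatMap endpoints (map f (upTo k)) ≡ concatMap (λ s → g s ∷ h s ∷ []) (upTo k)
    family-ends f g h k f-ends = trans (concatMap-map endpoints f (upTo k)) (concatMap-cong f-ends (upTo k))

  ends≡ : concatMap endpoints paths ≡
          hookEnds ++ concatMap (λ s → leftEnd s ∷ rightEnd s ∷ []) (upTo N′)
                   ++ concatMap (λ s → bottomEnd s ∷ topEnd s ∷ []) (upTo T′) ++ turnEnds ++ []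
  ends≡ = cong₂ _++_ hook-ends
    (trans (concatMap-++ endpoints (map bracket (upTo N′)) _)
      (cong₂ _++_ (family-ends bracket leftEnd rightEnd N′ bracket-ends)
        (trans (concatMap-++ endpoints (map drop (upTo T′)) _)
          (cong₂ _++_ (family-ends drop bottomEnd topEnd T′ drop-ends) (cong (_++ []) turn-ends)))))
    where
    hook-ends : endpoints hook ≡ hookEnds
    hook-ends = cong (λ z → (0 , 1) ∷ z ∷ []) (lastOf-++ (0 , 1) ((0 , 0) ∷ row t 1) (0 , T) ((0 , 2 + T′) ∷ []))
    bracket-ends : ∀ s → endpoints (bracket s) ≡ leftEnd s ∷ rightEnd s ∷ []
    bracket-ends s = cong (λ z → leftEnd s ∷ z ∷ []) (lastOf-++ (leftEnd s) (row t (2 + s)) (rightEnd s) [])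
    drop-ends : ∀ s → endpoints (drop s) ≡ bottomEnd s ∷ topEnd s ∷ []
    drop-ends s = cong (λ z → bottomEnd s ∷ z ∷ []) (lastOf-++ (bottomEnd s) (applyDownFrom (λ r → r , 1 + s) N) (topEnd s) [])
    turn-ends : endpoints turn ≡ turnEnds
    turn-ends = cong (λ z → (N , 1 + T′) ∷ z ∷ [])
      (trans (lastOf-++ (N , 1 + T′) (applyDownFrom (λ r → r , 1 + T′) N) (0 , 2 + T′) (applyUpTo (λ r → suc r , 2 + T′) N))
             (lastOf-applyUpTo (λ r → r , 2 + T′) N))

  private
    lefts rights bottoms tops : List (ℕ × ℕ)
    lefts   = map leftEnd (upTo N′)
    rights  = map rightEnd (upTo N′)
    bottoms = map bottomEnd (upTo T′)
    tops    = map topEnd (upTo T′)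

  ends↭ : concatMap endpoints paths ↭ hookEnds ++ lefts ++ rights ++ bottoms ++ tops ++ turnEnds
  ends↭ = subst (_↭ hookEnds ++ lefts ++ rights ++ bottoms ++ tops ++ turnEnds) (sym ends≡)
    (↭.++⁺ˡ hookEnds (↭-trans (concatMap-pairs-↭ leftEnd rightEnd (upTo N′) _)
                               (↭.++⁺ˡ lefts (↭.++⁺ˡ rights (concatMap-pairs-↭ bottomEnd topEnd (upTo T′) _)))))

  -- Each block of ends is separated from the later ones by the side of the box it lies on.
  ends-unique : Unique (hookEnds ++ lefts ++ rights ++ bottoms ++ tops ++ turnEnds)
  ends-unique =
    unique-++-separated (λ z → proj₁ z ≡ 0 × (proj₂ z ≡ 1 ⊎ proj₂ z ≡ 2 + T′)) (((λ ()) ∷ []) ∷ [] ∷ []) fromLefts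
      ((refl , inj₁ refl) ∷ (refl , inj₂ refl) ∷ [])
      (All.++⁺ (all-map-upTo leftEnd N′ (λ _ → λ { (() , _) }))
        (All.++⁺ (all-map-upTo rightEnd N′ (λ _ → λ { (() , _) }))
          (All.++⁺ (all-map-upTo bottomEnd T′ (λ _ → λ { (() , _) }))
            (All.++⁺ (all-map-upTo topEnd T′ (λ s< → λ { (_ , inj₁ ()) ; (_ , inj₂ e) → <⇒≢ (s≤s (s≤s s<)) e }))
                     ((λ { (() , _) }) ∷ (λ { (() , _) }) ∷ [])))))
    where
    fromTops : Unique (tops ++ turnEnds)
    fromTops =
      unique-++-separated (λ z → proj₁ z ≡ 0) (unique-map-upTo topEnd T′ (suc-injective ∘ suc-injective ∘ cong proj₂))
        (((λ e → 1+n≢n (sym (cong proj₂ e))) ∷ []) ∷ [] ∷ [])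
        (all-map-upTo topEnd T′ (λ _ → refl)) ((λ ()) ∷ (λ ()) ∷ [])

    fromBottoms : Unique (bottoms ++ tops ++ turnEnds)
    fromBottoms =
      unique-++-separated (λ z → proj₁ z ≡ N × proj₂ z ≤ T′) (unique-map-upTo bottomEnd T′ (suc-injective ∘ cong proj₂))
        fromTops (all-map-upTo bottomEnd T′ (λ s< → refl , s<))
        (All.++⁺ (all-map-upTo topEnd T′ (λ _ → λ ()))
                 ((λ (_ , le) → 1+n≰n le) ∷ (λ (_ , le) → 1+n≰n (<⇒≤ le)) ∷ []))

    fromRights : Unique (rights ++ bottoms ++ tops ++ turnEnds)
    fromRights =
      unique-++-separated (λ z → proj₂ z ≡ T) (unique-map-upTo rightEnd N′ (suc-injective ∘ cong proj₁))
        fromBottoms (all-map-upTo rightEnd N′ (λ _ → refl))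
        (All.++⁺ (all-map-upTo bottomEnd T′ (λ s< → <⇒≢ (s≤s (s≤s (m≤n⇒m≤1+n (<⇒≤ s<))))))
          (All.++⁺ (all-map-upTo topEnd T′ (λ s< → <⇒≢ (s≤s (s≤s (s≤s (<⇒≤ s<))))))
                   (<⇒≢ (s≤s (s≤s (n≤1+n T′))) ∷ <⇒≢ ≤-refl ∷ [])))

    fromLefts : Unique (lefts ++ rights ++ bottoms ++ tops ++ turnEnds)
    fromLefts =
      unique-++-separated (λ z → proj₂ z ≡ 0) (unique-map-upTo leftEnd N′ (suc-injective ∘ cong proj₁))
        fromRights (all-map-upTo leftEnd N′ (λ _ → refl))
        (All.++⁺ (all-map-upTo rightEnd N′ (λ _ → λ ()))
          (All.++⁺ (all-map-upTo bottomEnd T′ (λ _ → λ ()))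
            (All.++⁺ (all-map-upTo topEnd T′ (λ _ → λ ())) ((λ ()) ∷ (λ ()) ∷ []))))

  decomposition : BoxDecomposition n t
  decomposition = record
    { paths      = paths
    ; boxPaths   = areBoxPaths
    ; covers     = covers-by-counting paths areBoxPaths horizontal-covered vertical-covered steps
    ; endsUnique = unique-↭ (↭-sym ends↭) ends-unique
    }

boxDecomposition : ∀ n t → 1 ≤ n → 1 ≤ t → 4 ≤ n ⊔ t → BoxDecomposition n t
boxDecomposition 1 (suc (suc T)) _ _ _ = rowDecomposition T
boxDecomposition (suc (suc N)) 1 _ _ _ = swapBox (rowDecomposition N)
boxDecomposition (suc (suc N′)) (suc (suc (suc (suc T′)))) _ _ _ = LargeBox.decomposition N′ T′
boxDecomposition (suc (suc (suc (suc T′)))) 2 _ _ _ = swapBox (LargeBox.decomposition 0 T′)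
boxDecomposition (suc (suc (suc (suc T′)))) 3 _ _ _ = swapBox (LargeBox.decomposition 1 T′)
boxDecomposition 1 1 _ _ (s≤s ())
boxDecomposition 2 2 _ _ (s≤s (s≤s ()))
boxDecomposition 2 3 _ _ (s≤s (s≤s (s≤s ())))
boxDecomposition 3 2 _ _ (s≤s (s≤s (s≤s ())))
boxDecomposition 3 3 _ _ (s≤s (s≤s (s≤s ())))

lemma5p1 : ∀ (n t : ℕ) → 1 ≤ n → 1 ≤ t → 4 ≤ n ⊔ t →
    PathNumberIs (P n □ P t) (n-odd (P n □ P t) / 2)
lemma5p1 n t 1≤n 1≤t 4≤n⊔t = pathNumber-from-box (boxDecomposition n t 1≤n 1≤t 4≤n⊔t)
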